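{- Let $P$ be a graded bounded poset. Then the right augmented $\chi$-Chow polynomial of $P$ satisfies: \[ F_P(x) = Z_P(x) + x \sum_{\substack{t\in P\\ \rho(t)>1}} \H_{\operatorname{trunc}([\widehat{0},t])}(x)\, Z_{t\widehat{1}}(x).\]
   Context: $P$ is a finite graded bounded poset with minimum $\widehat{0}$ and maximum $\widehat{1}$, with rank function $\rho_{st}=\rho(t)-\rho(s)$, where $\rho(w)$ is the length of any saturated chain from $\widehat{0}$ to $w$. In the incidence algebra $\mathcal{I}(P)$ over $\mathbb{Z}[x]$ (product $(ab)_{st}=\sum_{s\le w\le t}a_{sw}b_{wt}$, identity $\delta$), let $\mathcal{I}_\rho(P)$ be the subalgebra of elements $a$ with $\deg a_{st}\le \rho_{st}$, with involution $(a^{\operatorname{rev}})_{st}(x)=x^{\rho_{st}}a_{st}(x^{ -1})$. Let $\zeta$ be the zeta function ($\zeta_{st}=1$ for all $s\le t$), $\mu=\zeta^{ -1}$ the Möbius function, and $\chi=\mu\cdot\zeta^{\operatorname{rev}}$ the characteristic function, which is a $P$-kernel (i.e. $\chi_{ss}=1$ and $\chi^{ -1}=\chi^{\operatorname{rev}}$). The right KLS function $f$ is the unique element with $f_{ss}=1$, $\deg f_{st}<\tfrac12\rho_{st}$ for $s<t$, and $f^{\operatorname{rev}}=\chi f$; the left KLS function is $g=\zeta$. The $Z$-function is $Z=g^{\operatorname{rev}}f$, and $Z_P=Z_{\widehat{0}\widehat{1}}$. The reduced kernel $\overline{\chi}$ is given by $\overline{\chi}_{st}(x)=\chi_{st}(x)/(x-1)$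 for $s<t$ and $\overline{\chi}_{ss}=-1$; the $\chi$-Chow function is $\H=-(\overline{\chi})^{ -1}$, and for a bounded poset $Q$, $\H_Q$ denotes $\H_{\widehat{0}_Q\widehat{1}_Q}$ computed in $Q$. The right augmented $\chi$-Chow function is $F=\H\cdot f^{\operatorname{rev}}$, and $F_P=F_{\widehat{0}\widehat{1}}$. For a graded bounded poset $Q$, $\operatorname{trunc}(Q)$ is the subposet consisting of all elements of $Q$ except the coatoms of $Q$. -}

module Defs where

open import Data.Nat as ℕ using (ℕ; zero; suc; _∸_; _≤ᵇ_)
open import Data.Integer as ℤ using (ℤ; 0ℤ; 1ℤ)
open import Data.Fin as Fin using (Fin)
open import Data.Bool using (Bool; true; false; _∧_; not; if_then_else_)
open import Data.List using (List; []; _∷_; foldr; filterᵇ; upTo; allFin; length)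
open import Data.Bool.ListAction using (any)
open import Data.Product using (_×_)
open import Data.Sum using (_⊎_)
open import Relation.Nullary using (¬_; does)
open import Relation.Binary.PropositionalEquality using (_≡_; _≢_)
open import Relation.Binary using (Decidable)

-- Polynomials over ℤ, represented by their coefficient sequences
-- (coefficient of x^i is  p i ).  Equality is coefficientwise.

Poly : Set
Poly = ℕ → ℤ

_≈ₚ_ : Poly → Poly → Set
p ≈ₚ q = ∀ i → p i ≡ q i

infix 4 _≈ₚ_
infixl 6 _+ₚ_
infixl 7 _*ₚ_

0ₚ : Poly
0ₚ _ = 0ℤ

1ₚ : Poly
1ₚ zero = 1ℤ
1ₚ (suc _) = 0ℤ

Xₚ : Poly
Xₚ 1 = 1ℤ
Xₚ _ = 0ℤ

_+ₚ_ : Poly → Poly → Poly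
(p +ₚ q) i = p i ℤ.+ q i

-ₚ_ : Poly → Poly
(-ₚ p) i = ℤ.- (p i)

sumℤ : List ℤ → ℤ
sumℤ = foldr ℤ._+_ 0ℤ

_*ₚ_ : Poly → Poly → Poly
(p *ₚ q) k = sumℤ (Data.List.map (λ i → p i ℤ.* q (k ∸ i)) (upTo (suc k)))

Σₚ : {A : Set} → List A → (A → Poly) → Poly
Σₚ xs f = foldr (λ a acc → f a +ₚ acc) 0ₚ xs

-- x^k p(x^{-1}) for a polynomial of degree ≤ k
revₚ : ℕ → Poly → Poly
revₚ k p i = if i ≤ᵇ k then p (k ∸ i) else 0ℤ

-- p(x)/(x-1), for p with p(1) = 0 (exact division):
-- q_i = - (p_0 + ... + p_i)
div-x-1 : Poly → Poly
div-x-1 p i = ℤ.- sumℤ (Data.List.map p (upTo (suc i)))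

record GradedBoundedPoset : Set₁ where
  field
    n        : ℕ
    _≼_      : Fin n → Fin n → Set
    _≼?_     : Decidable _≼_
    ≼-refl   : ∀ {s} → s ≼ s
    ≼-antisym : ∀ {s t} → s ≼ t → t ≼ s → s ≡ t
    ≼-trans  : ∀ {s t u} → s ≼ t → t ≼ u → s ≼ u
    bot      : Fin n
    top      : Fin n
    bot-min  : ∀ s → bot ≼ s
    top-max  : ∀ s → s ≼ top
    ρ        : Fin n → ℕ
    ρ-bot    : ρ bot ≡ 0
    ρ-cover  : ∀ {s t} → s ≼ t → s ≢ t
               → (∀ w → s ≼ w → w ≼ t → w ≡ s ⊎ w ≡ t)
               → ρ t ≡ suc (ρ s)

module Incidence (P : GradedBoundedPoset) where
  open GradedBoundedPoset P public

  -- incidence-algebra elements: a s t is meaningful for s ≼ t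
  Inc : Set
  Inc = Fin n → Fin n → Poly

  leq : Fin n → Fin n → Bool
  leq s t = does (s ≼? t)

  eqb : Fin n → Fin n → Bool
  eqb s t = does (s Fin.≟ t)

  ltb : Fin n → Fin n → Bool
  ltb s t = leq s t ∧ not (eqb s t)

  covb : Fin n → Fin n → Bool
  covb w t = ltb w t ∧ not (any (λ z → ltb w z ∧ ltb z t) (allFin n))

  δ : Inc
  δ s t = if eqb s t then 1ₚ else 0ₚ

  ζ : Inc
  ζ _ _ = 1ₚ

  -- Operations in the incidence algebra of an (induced) subposet Q,
  -- given by its list of elements L and its rank function r.
  module Sub (L : List (Fin n)) (r : Fin n → ℕ) where

    _·_ : Inc → Inc → Inc
    (a · b) s t = Σₚ (filterᵇ (λ w → leq s w ∧ leq w t) L) (λ w → a s w *ₚ b w t)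

    rev : Inc → Inc
    rev a s t = revₚ (r t ∸ r s) (a s t)

    -- inverse of an element whose diagonal entries are ±1, computed by
    -- the recursion  b_tt = a_tt,  b_st = - a_tt Σ_{s≤w<t} b_sw a_wt
    -- (fuel bounds the length of chains in Q)
    invF : ℕ → Inc → Inc
    invF zero a s t = 0ₚ
    invF (suc k) a s t =
      if eqb s t then a t t
      else -ₚ (a t t *ₚ Σₚ (filterᵇ (λ w → leq s w ∧ ltb w t) L)
                              (λ w → invF k a s w *ₚ a w t))

    inv : Inc → Inc
    inv a = invF (length L) a

    μ : Inc
    μ = inv ζ

    χ : Inc
    χ = μ · rev ζ

    χbar : Inc
    χbar s t = if eqb s t then -ₚ 1ₚ else div-x-1 (χ s t)

    H : Inc
    H s t = -ₚ (inv χbar s t)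

  module Whole = Sub (allFin n) ρ

  record IsRightKLS (f : Inc) : Set where
    field
      diag : ∀ s → f s s ≈ₚ 1ₚ
      deg  : ∀ s t → s ≼ t → s ≢ t → ∀ i → ρ t ∸ ρ s ℕ.≤ 2 ℕ.* i → f s t i ≡ 0ℤ
      rev≡ : ∀ s t → s ≼ t → Whole.rev f s t ≈ₚ (Whole.χ Whole.· f) s t

  Z : Inc → Inc
  Z f = Whole.rev ζ Whole.· f

  F : Inc → Inc
  F f = Whole.H Whole.· Whole.rev f

  truncElems : Fin n → List (Fin n)
  truncElems t = filterᵇ (λ w → leq w t ∧ not (covb w t)) (allFin n)

  truncRank : Fin n → Fin n → ℕ
  truncRank t w = if eqb w t then ρ t ∸ 1 else ρ w

  Htrunc : Fin n → Poly
  Htrunc t = Sub.H (truncElems t) (truncRank t) bot t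

  rankAbove1 : List (Fin n)
  rankAbove1 = filterᵇ (λ t → 2 ≤ᵇ ρ t) (allFin n)

module Submission where

open import Defs
open import Data.Nat using (ℕ; zero; suc; _∸_; _<_; _≤_; _≤ᵇ_; z≤n; s≤s)
import Data.Nat.Properties as ℕ
open import Data.Integer using (ℤ; 0ℤ; 1ℤ; _+_; _*_; -_)
import Data.Integer.Properties as ℤ
open import Data.Integer.Tactic.RingSolver using (solve-∀)
open import Data.Bool using (Bool; true; false; if_then_else_; not; _∧_; T?)
open import Data.Bool.Properties
  using (∧-conicalˡ; ∧-conicalʳ; ∧-zeroʳ; T-≡; ¬-not; not-¬; not-injective)
open import Data.Bool.ListAction using (any)
open import Data.Fin as Fin using (Fin)
open import Data.List using (List; []; _∷_; map; applyUpTo; upTo; filterᵇ; allFin; length)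
open import Data.List.Properties using (map-applyUpTo; map-tabulate; foldr-map; filter-notAll)
open import Data.List.Membership.Propositional using (_∈_)
open import Data.List.Membership.Propositional.Properties using (∈-allFin; ∈-filter⁺; ∈-filter⁻)
open import Data.List.Relation.Unary.Any as Any using (here; there)
open import Data.Product using (_×_; _,_; proj₁; proj₂; ∃; map₂)
open import Data.Sum using (_⊎_; inj₁; inj₂)
open import Data.Empty using (⊥-elim)
open import Function using (_∘_; id; Equivalence)
open import Relation.Nullary using (yes; no; does)
open import Relation.Binary.Bundles using (Setoid)
open import Relation.Binary.PropositionalEquality
import Relation.Binary.Reasoning.Setoid as ≈-Reasoning

-- Put Hμ = H·μ in the incidence algebra of P, and let β(s,t) = [ρ(t) − ρ(s)]ₓ and
-- β′(s,t) = [ρ(t) − ρ(s) − 1]ₓ, where [k]ₓ = 1 + x + ⋯ + x^(k−1).  Since f^rev = χ f and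
-- χ = μ ζ^rev, associativity turns F = H f^rev into Hμ·Z, so F_P = Σ_w Hμ(0̂,w) Z_{w1̂} and it
-- remains to compute Hμ(0̂,w).
-- On the one hand μζ = δ gives H = Hμ·ζ.  On the other hand Σ_{s≤u≤t} μ(s,u) = 0 for s < t, so
-- dividing χ(s,t) = Σ_u μ(s,u) x^(ρ(t)−ρ(u)) by x − 1 gives χ̄ = μ·β off the diagonal, and
-- H χ̄ = −δ with χ̄(t,t) = −1 turns into H = Hμ·β away from 0̂.  Subtracting the two expressions
-- for H(0̂,t) and using [k]ₓ − 1 = x [k−1]ₓ leaves Hμ(0̂,t) = x (Hμ·β′)(0̂,t) for t ≠ 0̂.
-- If ρ(t) = 1 every β′(u,t) vanishes, so Hμ(0̂,t) = 0.  If ρ(t) ≥ 2 the same computation runs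
-- inside trunc([0̂,t]): there t has rank ρ(t) − 1, the other elements form a down-set of P on
-- which μ, χ̄ and H agree with those of P, and the removed coatoms u of [0̂,t] would only have
-- contributed β′(u,t) = [0]ₓ = 0.  Hence H_trunc([0̂,t]) = (Hμ·β′)(0̂,t), that is,
-- Hμ(0̂,t) = x H_trunc([0̂,t]).

≈ₚ-refl : ∀ {p} → p ≈ₚ p
≈ₚ-refl i = refl

≈ₚ-sym : ∀ {p q} → p ≈ₚ q → q ≈ₚ p
≈ₚ-sym e i = sym (e i)

≈ₚ-trans : ∀ {p q r} → p ≈ₚ q → q ≈ₚ r → p ≈ₚ r
≈ₚ-trans e f i = trans (e i) (f i)

≈ₚ-setoid : Setoid _ _
≈ₚ-setoid = record
  { Carrier = Poly ; _≈_ = _≈ₚ_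
  ; isEquivalence = record { refl = ≈ₚ-refl ; sym = ≈ₚ-sym ; trans = ≈ₚ-trans } }

+ₚ-cong : ∀ {p p′ q q′} → p ≈ₚ p′ → q ≈ₚ q′ → p +ₚ q ≈ₚ p′ +ₚ q′
+ₚ-cong e f i = cong₂ _+_ (e i) (f i)

+ₚ-congˡ : ∀ p {q q′} → q ≈ₚ q′ → p +ₚ q ≈ₚ p +ₚ q′
+ₚ-congˡ p = +ₚ-cong (≈ₚ-refl {p})

-ₚ-cong : ∀ {p p′} → p ≈ₚ p′ → -ₚ p ≈ₚ -ₚ p′
-ₚ-cong e i = cong -_ (e i)

+ₚ-identityˡ : ∀ p → 0ₚ +ₚ p ≈ₚ p
+ₚ-identityˡ p i = ℤ.+-identityˡ (p i)

+ₚ-identityʳ : ∀ p → p +ₚ 0ₚ ≈ₚ p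
+ₚ-identityʳ p i = ℤ.+-identityʳ (p i)

+ₚ-inverseʳ : ∀ p → p +ₚ (-ₚ p) ≈ₚ 0ₚ
+ₚ-inverseʳ p i = ℤ.+-inverseʳ (p i)

-ₚ-involutive : ∀ p → -ₚ (-ₚ p) ≈ₚ p
-ₚ-involutive p i = ℤ.neg-involutive (p i)

tailₚ : Poly → Poly
tailₚ p i = p (suc i)

sum< : (ℕ → ℤ) → ℕ → ℤ
sum< f n = sumℤ (applyUpTo f n)

sum<-cong : ∀ {f g} n → (∀ i → f i ≡ g i) → sum< f n ≡ sum< g n
sum<-cong zero e = refl
sum<-cong (suc n) e = cong₂ _+_ (e 0) (sum<-cong n (e ∘ suc))

sum<-+ : ∀ f g n → sum< (λ i → f i + g i) n ≡ sum< f n + sum< g n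
sum<-+ f g zero = refl
sum<-+ f g (suc n) = trans (cong (f 0 + g 0 +_) (sum<-+ (f ∘ suc) (g ∘ suc) n))
  (interchange (f 0) (g 0) (sum< (f ∘ suc) n) (sum< (g ∘ suc) n))
  where
  interchange : ∀ a b c d → a + b + (c + d) ≡ a + c + (b + d)
  interchange = solve-∀

sum<-*ˡ : ∀ c f n → sum< (λ i → c * f i) n ≡ c * sum< f n
sum<-*ˡ c f zero = sym (ℤ.*-zeroʳ c)
sum<-*ˡ c f (suc n) = trans (cong (c * f 0 +_) (sum<-*ˡ c (f ∘ suc) n))
  (sym (ℤ.*-distribˡ-+ c (f 0) _))

sum<-neg : ∀ f n → sum< (λ i → - f i) n ≡ - sum< f n
sum<-neg f zero = refl
sum<-neg f (suc n) = trans (cong (- f 0 +_) (sum<-neg (f ∘ suc) n))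
  (sym (ℤ.neg-distrib-+ (f 0) _))

sum<-zero : ∀ n → sum< (λ _ → 0ℤ) n ≡ 0ℤ
sum<-zero zero = refl
sum<-zero (suc n) = trans (ℤ.+-identityˡ _) (sum<-zero n)

*ₚ-as-sum< : ∀ p q k → (p *ₚ q) k ≡ sum< (λ i → p i * q (k ∸ i)) (suc k)
*ₚ-as-sum< p q k = cong sumℤ (map-applyUpTo id (λ i → p i * q (k ∸ i)) (suc k))

*ₚ-suc : ∀ p q k → (p *ₚ q) (suc k) ≡ p 0 * q (suc k) + (tailₚ p *ₚ q) k
*ₚ-suc p q k = trans (*ₚ-as-sum< p q (suc k))
  (cong (p 0 * q (suc k) +_) (sym (*ₚ-as-sum< (tailₚ p) q k)))

*ₚ-as-sum<′ : ∀ p q k {F : ℕ → ℤ} → (∀ i → p i * q (k ∸ i) ≡ F i) → (p *ₚ q) k ≡ sum< F (suc k)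
*ₚ-as-sum<′ p q k e = trans (*ₚ-as-sum< p q k) (sum<-cong (suc k) e)

*ₚ-cong : ∀ {p p′ q q′} → p ≈ₚ p′ → q ≈ₚ q′ → p *ₚ q ≈ₚ p′ *ₚ q′
*ₚ-cong {p} {p′} {q} {q′} e f k = trans (*ₚ-as-sum<′ p q k (λ i → cong₂ _*_ (e i) (f (k ∸ i))))
  (sym (*ₚ-as-sum< p′ q′ k))

*ₚ-congˡ : ∀ p {q q′} → q ≈ₚ q′ → p *ₚ q ≈ₚ p *ₚ q′
*ₚ-congˡ p = *ₚ-cong (≈ₚ-refl {p})

*ₚ-congʳ : ∀ q {p p′} → p ≈ₚ p′ → p *ₚ q ≈ₚ p′ *ₚ q
*ₚ-congʳ q e = *ₚ-cong e (≈ₚ-refl {q})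

*ₚ-distribʳ-+ₚ : ∀ p p′ q → (p +ₚ p′) *ₚ q ≈ₚ p *ₚ q +ₚ p′ *ₚ q
*ₚ-distribʳ-+ₚ p p′ q k = begin
  ((p +ₚ p′) *ₚ q) k
    ≡⟨ *ₚ-as-sum<′ (p +ₚ p′) q k (λ i → ℤ.*-distribʳ-+ (q (k ∸ i)) (p i) (p′ i)) ⟩
  sum< (λ i → p i * q (k ∸ i) + p′ i * q (k ∸ i)) (suc k)
    ≡⟨ sum<-+ (λ i → p i * q (k ∸ i)) (λ i → p′ i * q (k ∸ i)) (suc k) ⟩
  sum< (λ i → p i * q (k ∸ i)) (suc k) + sum< (λ i → p′ i * q (k ∸ i)) (suc k)
    ≡⟨ cong₂ _+_ (*ₚ-as-sum< p q k) (*ₚ-as-sum< p′ q k) ⟨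
  (p *ₚ q +ₚ p′ *ₚ q) k ∎
  where open ≡-Reasoning

*ₚ-distribˡ-+ₚ : ∀ p q q′ → p *ₚ (q +ₚ q′) ≈ₚ p *ₚ q +ₚ p *ₚ q′
*ₚ-distribˡ-+ₚ p q q′ k = begin
  (p *ₚ (q +ₚ q′)) k
    ≡⟨ *ₚ-as-sum<′ p (q +ₚ q′) k (λ i → ℤ.*-distribˡ-+ (p i) (q (k ∸ i)) (q′ (k ∸ i))) ⟩
  sum< (λ i → p i * q (k ∸ i) + p i * q′ (k ∸ i)) (suc k)
    ≡⟨ sum<-+ (λ i → p i * q (k ∸ i)) (λ i → p i * q′ (k ∸ i)) (suc k) ⟩
  sum< (λ i → p i * q (k ∸ i)) (suc k) + sum< (λ i → p i * q′ (k ∸ i)) (suc k)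
    ≡⟨ cong₂ _+_ (*ₚ-as-sum< p q k) (*ₚ-as-sum< p q′ k) ⟨
  (p *ₚ q +ₚ p *ₚ q′) k ∎
  where open ≡-Reasoning

*ₚ-negˡ : ∀ p q → (-ₚ p) *ₚ q ≈ₚ -ₚ (p *ₚ q)
*ₚ-negˡ p q k = trans (*ₚ-as-sum<′ (-ₚ p) q k (λ i → sym (ℤ.neg-distribˡ-* (p i) (q (k ∸ i)))))
  (trans (sum<-neg (λ i → p i * q (k ∸ i)) (suc k)) (cong -_ (sym (*ₚ-as-sum< p q k))))

*ₚ-negʳ : ∀ p q → p *ₚ (-ₚ q) ≈ₚ -ₚ (p *ₚ q)
*ₚ-negʳ p q k = trans (*ₚ-as-sum<′ p (-ₚ q) k (λ i → sym (ℤ.neg-distribʳ-* (p i) (q (k ∸ i)))))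
  (trans (sum<-neg (λ i → p i * q (k ∸ i)) (suc k)) (cong -_ (sym (*ₚ-as-sum< p q k))))

*ₚ-zeroˡ : ∀ q → 0ₚ *ₚ q ≈ₚ 0ₚ
*ₚ-zeroˡ q k = trans (*ₚ-as-sum<′ 0ₚ q k (λ i → ℤ.*-zeroˡ (q (k ∸ i)))) (sum<-zero (suc k))

*ₚ-zeroʳ : ∀ p → p *ₚ 0ₚ ≈ₚ 0ₚ
*ₚ-zeroʳ p k = trans (*ₚ-as-sum<′ p 0ₚ k (λ i → ℤ.*-zeroʳ (p i))) (sum<-zero (suc k))

_·ₚ_ : ℤ → Poly → Poly
(c ·ₚ p) i = c * p i

*ₚ-·ₚ-assoc : ∀ c p q → (c ·ₚ p) *ₚ q ≈ₚ c ·ₚ (p *ₚ q)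
*ₚ-·ₚ-assoc c p q k = trans (*ₚ-as-sum<′ (c ·ₚ p) q k (λ i → ℤ.*-assoc c (p i) (q (k ∸ i))))
  (trans (sum<-*ˡ c (λ i → p i * q (k ∸ i)) (suc k)) (cong (c *_) (sym (*ₚ-as-sum< p q k))))

*ₚ-assoc : ∀ p q r → (p *ₚ q) *ₚ r ≈ₚ p *ₚ (q *ₚ r)
*ₚ-assoc p q r zero = regroup (p 0) (q 0) (r 0)
  where
  regroup : ∀ a b c → (a * b + 0ℤ) * c + 0ℤ ≡ a * (b * c + 0ℤ) + 0ℤ
  regroup = solve-∀
*ₚ-assoc p q r (suc k) = begin
  ((p *ₚ q) *ₚ r) (suc k)
    ≡⟨ *ₚ-suc (p *ₚ q) r k ⟩
  (p 0 * q 0 + 0ℤ) * r (suc k) + (tailₚ (p *ₚ q) *ₚ r) k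
    ≡⟨ cong ((p 0 * q 0 + 0ℤ) * r (suc k) +_) (*ₚ-congʳ r (*ₚ-suc p q) k) ⟩
  (p 0 * q 0 + 0ℤ) * r (suc k) + ((p 0 ·ₚ tailₚ q +ₚ tailₚ p *ₚ q) *ₚ r) k
    ≡⟨ cong ((p 0 * q 0 + 0ℤ) * r (suc k) +_) (*ₚ-distribʳ-+ₚ (p 0 ·ₚ tailₚ q) (tailₚ p *ₚ q) r k) ⟩
  (p 0 * q 0 + 0ℤ) * r (suc k) + (((p 0 ·ₚ tailₚ q) *ₚ r) k + ((tailₚ p *ₚ q) *ₚ r) k)
    ≡⟨ cong₂ (λ a b → (p 0 * q 0 + 0ℤ) * r (suc k) + (a + b))
         (*ₚ-·ₚ-assoc (p 0) (tailₚ q) r k) (*ₚ-assoc (tailₚ p) q r k) ⟩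
  (p 0 * q 0 + 0ℤ) * r (suc k) + (p 0 * (tailₚ q *ₚ r) k + (tailₚ p *ₚ (q *ₚ r)) k)
    ≡⟨ regroup (p 0) (q 0) (r (suc k)) _ _ ⟩
  p 0 * (q 0 * r (suc k) + (tailₚ q *ₚ r) k) + (tailₚ p *ₚ (q *ₚ r)) k
    ≡⟨ cong (λ z → p 0 * z + (tailₚ p *ₚ (q *ₚ r)) k) (*ₚ-suc q r k) ⟨
  p 0 * (q *ₚ r) (suc k) + (tailₚ p *ₚ (q *ₚ r)) k
    ≡⟨ *ₚ-suc p (q *ₚ r) k ⟨
  (p *ₚ (q *ₚ r)) (suc k) ∎
  where
  open ≡-Reasoning
  regroup : ∀ a b c d e → (a * b + 0ℤ) * c + (a * d + e) ≡ a * (b * c + d) + e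
  regroup = solve-∀

*ₚ-identityˡ : ∀ p → 1ₚ *ₚ p ≈ₚ p
*ₚ-identityˡ p zero = trans (ℤ.+-identityʳ _) (ℤ.*-identityˡ (p 0))
*ₚ-identityˡ p (suc k) = trans (*ₚ-suc 1ₚ p k)
  (trans (cong₂ _+_ (ℤ.*-identityˡ (p (suc k))) (*ₚ-zeroˡ p k)) (ℤ.+-identityʳ _))

*ₚ-identityʳ : ∀ p → p *ₚ 1ₚ ≈ₚ p
*ₚ-identityʳ p zero = trans (ℤ.+-identityʳ _) (ℤ.*-identityʳ (p 0))
*ₚ-identityʳ p (suc k) = trans (*ₚ-suc p 1ₚ k)
  (trans (cong₂ _+_ (ℤ.*-zeroʳ (p 0)) (*ₚ-identityʳ (tailₚ p) k)) (ℤ.+-identityˡ _))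

Xₚ-*ₚ-zero : ∀ p → (Xₚ *ₚ p) 0 ≡ 0ℤ
Xₚ-*ₚ-zero p = cong (_+ 0ℤ) (ℤ.*-zeroˡ (p 0))

Xₚ-*ₚ-suc : ∀ p k → (Xₚ *ₚ p) (suc k) ≡ p k
Xₚ-*ₚ-suc p k = trans (*ₚ-suc Xₚ p k)
  (trans (cong₂ _+_ (ℤ.*-zeroˡ (p (suc k))) (trans (*ₚ-congʳ p tailₚXₚ≈1ₚ k) (*ₚ-identityˡ p k)))
    (ℤ.+-identityˡ _))
  where
  tailₚXₚ≈1ₚ : tailₚ Xₚ ≈ₚ 1ₚ
  tailₚXₚ≈1ₚ zero = refl
  tailₚXₚ≈1ₚ (suc i) = refl

*ₚ-Xₚ-zero : ∀ p → (p *ₚ Xₚ) 0 ≡ 0ℤ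
*ₚ-Xₚ-zero p = cong (_+ 0ℤ) (ℤ.*-zeroʳ (p 0))

*ₚ-Xₚ-suc : ∀ p k → (p *ₚ Xₚ) (suc k) ≡ p k
*ₚ-Xₚ-suc p zero = trans (*ₚ-suc p Xₚ 0)
  (trans (cong₂ _+_ (ℤ.*-identityʳ (p 0)) (*ₚ-Xₚ-zero (tailₚ p))) (ℤ.+-identityʳ _))
*ₚ-Xₚ-suc p (suc k) = trans (*ₚ-suc p Xₚ (suc k))
  (trans (cong₂ _+_ (ℤ.*-zeroʳ (p 0)) (*ₚ-Xₚ-suc (tailₚ p) k)) (ℤ.+-identityˡ _))

Xₚ-comm : ∀ p → Xₚ *ₚ p ≈ₚ p *ₚ Xₚ
Xₚ-comm p zero = trans (Xₚ-*ₚ-zero p) (sym (*ₚ-Xₚ-zero p))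
Xₚ-comm p (suc k) = trans (Xₚ-*ₚ-suc p k) (sym (*ₚ-Xₚ-suc p k))

*ₚ-Xₚ-swap : ∀ p q → p *ₚ (Xₚ *ₚ q) ≈ₚ Xₚ *ₚ (p *ₚ q)
*ₚ-Xₚ-swap p q = ≈ₚ-trans (≈ₚ-sym (*ₚ-assoc p Xₚ q))
  (≈ₚ-trans (*ₚ-congʳ q (≈ₚ-sym (Xₚ-comm p))) (*ₚ-assoc Xₚ p q))

*ₚ-+ₚ-1 : ∀ p q → p *ₚ q +ₚ -ₚ (p *ₚ 1ₚ) ≈ₚ p *ₚ (q +ₚ -ₚ 1ₚ)
*ₚ-+ₚ-1 p q = ≈ₚ-trans (+ₚ-congˡ (p *ₚ q) (≈ₚ-sym (*ₚ-negʳ p 1ₚ))) (≈ₚ-sym (*ₚ-distribˡ-+ₚ p q (-ₚ 1ₚ)))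

+ₚ-cancelˡ : ∀ {a m b} → a +ₚ m ≈ₚ b → m ≈ₚ b +ₚ -ₚ a
+ₚ-cancelˡ {a} {m} {b} e i = trans (rearrange (a i) (m i)) (cong (_+ - a i) (e i))
  where
  rearrange : ∀ a m → m ≡ a + m + - a
  rearrange = solve-∀

infixr 8 [_]·_

[_]·_ : Bool → Poly → Poly
[ b ]· p = if b then p else 0ₚ

[]·-cong : ∀ b {p q} → (b ≡ true → p ≈ₚ q) → [ b ]· p ≈ₚ [ b ]· q
[]·-cong true e = e refl
[]·-cong false e = ≈ₚ-refl

[]·-≡ : ∀ {a b p q} → a ≡ b → (a ≡ true → p ≈ₚ q) → [ a ]· p ≈ₚ [ b ]· q
[]·-≡ {a} refl = []·-cong a

[]·-true : ∀ {b} p → b ≡ true → [ b ]· p ≈ₚ p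
[]·-true p refl = ≈ₚ-refl

[]·-zero : ∀ b {p} → (b ≡ true → p ≈ₚ 0ₚ) → [ b ]· p ≈ₚ 0ₚ
[]·-zero true e = e refl
[]·-zero false e = ≈ₚ-refl

[]·-[]· : ∀ a b p → [ a ]· [ b ]· p ≈ₚ [ a ∧ b ]· p
[]·-[]· true b p = ≈ₚ-refl
[]·-[]· false b p = ≈ₚ-refl

[]·-+ₚ : ∀ b p q → [ b ]· (p +ₚ q) ≈ₚ [ b ]· p +ₚ [ b ]· q
[]·-+ₚ true p q = ≈ₚ-refl
[]·-+ₚ false p q = ≈ₚ-sym (+ₚ-identityˡ 0ₚ)

[]·-negₚ : ∀ b p → [ b ]· (-ₚ p) ≈ₚ -ₚ ([ b ]· p)
[]·-negₚ true p = ≈ₚ-refl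
[]·-negₚ false p = ≈ₚ-refl

*ₚ-[]· : ∀ b p q → p *ₚ [ b ]· q ≈ₚ [ b ]· (p *ₚ q)
*ₚ-[]· true p q = ≈ₚ-refl
*ₚ-[]· false p q = *ₚ-zeroʳ p

[]·-*ₚ : ∀ b p q → [ b ]· p *ₚ q ≈ₚ [ b ]· (p *ₚ q)
[]·-*ₚ true p q = ≈ₚ-refl
[]·-*ₚ false p q = *ₚ-zeroˡ q

[]·-partition : ∀ a b c p → (a ≡ true → b ≡ true ⊎ c ≡ true) → (b ≡ true → a ≡ true) →
        (c ≡ true → a ≡ true) → (b ≡ true → c ≡ false) → [ a ]· p ≈ₚ [ b ]· p +ₚ [ c ]· p
[]·-partition a true true p _ _ _ b⇒¬c with () ← b⇒¬c refl
[]·-partition a true false p _ b⇒a _ _ rewrite b⇒a refl = ≈ₚ-sym (+ₚ-identityʳ p)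
[]·-partition a false true p _ _ c⇒a _ rewrite c⇒a refl = ≈ₚ-sym (+ₚ-identityˡ p)
[]·-partition true false false p a⇒b∨c _ _ _ with a⇒b∨c refl
... | inj₁ ()
... | inj₂ ()
[]·-partition false false false p _ _ _ _ = ≈ₚ-sym (+ₚ-identityˡ 0ₚ)

module _ {A : Set} where

  Σₚ-cong : ∀ xs {f g : A → Poly} → (∀ x → f x ≈ₚ g x) → Σₚ xs f ≈ₚ Σₚ xs g
  Σₚ-cong [] e i = refl
  Σₚ-cong (x ∷ xs) e i = cong₂ _+_ (e x i) (Σₚ-cong xs e i)

  Σₚ-cong-∈ : ∀ xs {f g : A → Poly} → (∀ {x} → x ∈ xs → f x ≈ₚ g x) → Σₚ xs f ≈ₚ Σₚ xs g
  Σₚ-cong-∈ [] e i = refl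
  Σₚ-cong-∈ (x ∷ xs) e i = cong₂ _+_ (e (here refl) i) (Σₚ-cong-∈ xs (e ∘ there) i)

  Σₚ-+ₚ : ∀ xs (f g : A → Poly) → Σₚ xs (λ x → f x +ₚ g x) ≈ₚ Σₚ xs f +ₚ Σₚ xs g
  Σₚ-+ₚ [] f g i = refl
  Σₚ-+ₚ (x ∷ xs) f g i = trans (cong (f x i + g x i +_) (Σₚ-+ₚ xs f g i))
    (interchange (f x i) (g x i) _ _)
    where
    interchange : ∀ a b c d → a + b + (c + d) ≡ a + c + (b + d)
    interchange = solve-∀

  Σₚ-0ₚ : ∀ xs → Σₚ xs (λ (_ : A) → 0ₚ) ≈ₚ 0ₚ
  Σₚ-0ₚ [] i = refl
  Σₚ-0ₚ (x ∷ xs) i = trans (ℤ.+-identityˡ _) (Σₚ-0ₚ xs i)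

  Σₚ-zero : ∀ xs (f : A → Poly) → (∀ x → f x ≈ₚ 0ₚ) → Σₚ xs f ≈ₚ 0ₚ
  Σₚ-zero xs f e = ≈ₚ-trans (Σₚ-cong xs e) (Σₚ-0ₚ xs)

  -ₚ-Σₚ : ∀ xs (f : A → Poly) → -ₚ Σₚ xs f ≈ₚ Σₚ xs (λ x → -ₚ f x)
  -ₚ-Σₚ [] f i = refl
  -ₚ-Σₚ (x ∷ xs) f i = trans (ℤ.neg-distrib-+ (f x i) _) (cong (- f x i +_) (-ₚ-Σₚ xs f i))

  *ₚ-Σₚ : ∀ xs p (f : A → Poly) → p *ₚ Σₚ xs f ≈ₚ Σₚ xs (λ x → p *ₚ f x)
  *ₚ-Σₚ [] p f = *ₚ-zeroʳ p
  *ₚ-Σₚ (x ∷ xs) p f = ≈ₚ-trans (*ₚ-distribˡ-+ₚ p (f x) (Σₚ xs f)) (+ₚ-congˡ (p *ₚ f x) (*ₚ-Σₚ xs p f))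

  Σₚ-*ₚ : ∀ xs p (f : A → Poly) → Σₚ xs f *ₚ p ≈ₚ Σₚ xs (λ x → f x *ₚ p)
  Σₚ-*ₚ [] p f = *ₚ-zeroˡ p
  Σₚ-*ₚ (x ∷ xs) p f = ≈ₚ-trans (*ₚ-distribʳ-+ₚ (f x) (Σₚ xs f) p) (+ₚ-congˡ (f x *ₚ p) (Σₚ-*ₚ xs p f))

  []·-Σₚ : ∀ xs b (f : A → Poly) → [ b ]· Σₚ xs f ≈ₚ Σₚ xs (λ x → [ b ]· f x)
  []·-Σₚ xs true f = ≈ₚ-refl
  []·-Σₚ xs false f = ≈ₚ-sym (Σₚ-0ₚ xs)

  []·-Σₚ-*ₚ : ∀ xs a (b : A → Bool) (g : A → Poly) q →
              [ a ]· (Σₚ xs (λ x → [ b x ]· g x) *ₚ q) ≈ₚ Σₚ xs (λ x → [ a ∧ b x ]· (g x *ₚ q))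
  []·-Σₚ-*ₚ xs a b g q = ≈ₚ-trans ([]·-cong a λ _ → Σₚ-*ₚ xs q (λ x → [ b x ]· g x))
    (≈ₚ-trans ([]·-Σₚ xs a (λ x → [ b x ]· g x *ₚ q)) (Σₚ-cong xs λ x →
      ≈ₚ-trans ([]·-cong a λ _ → []·-*ₚ (b x) (g x) q) ([]·-[]· a (b x) (g x *ₚ q))))

  []·-*ₚ-Σₚ : ∀ xs a (b : A → Bool) p (g : A → Poly) →
              [ a ]· (p *ₚ Σₚ xs (λ x → [ b x ]· g x)) ≈ₚ Σₚ xs (λ x → [ a ∧ b x ]· (p *ₚ g x))
  []·-*ₚ-Σₚ xs a b p g = ≈ₚ-trans ([]·-cong a λ _ → *ₚ-Σₚ xs p (λ x → [ b x ]· g x))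
    (≈ₚ-trans ([]·-Σₚ xs a (λ x → p *ₚ [ b x ]· g x)) (Σₚ-cong xs λ x →
      ≈ₚ-trans ([]·-cong a λ _ → *ₚ-[]· (b x) p (g x)) ([]·-[]· a (b x) (p *ₚ g x))))

  Σₚ-filterᵇ : ∀ xs (b : A → Bool) (f : A → Poly) → Σₚ (filterᵇ b xs) f ≈ₚ Σₚ xs (λ x → [ b x ]· f x)
  Σₚ-filterᵇ [] b f i = refl
  Σₚ-filterᵇ (x ∷ xs) b f i with b x
  ... | true = cong (f x i +_) (Σₚ-filterᵇ xs b f i)
  ... | false = trans (Σₚ-filterᵇ xs b f i) (sym (ℤ.+-identityˡ _))

Σₚ-comm : ∀ {A B : Set} (xs : List A) (ys : List B) (g : A → B → Poly) →
          Σₚ xs (λ a → Σₚ ys (g a)) ≈ₚ Σₚ ys (λ b → Σₚ xs (λ a → g a b))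
Σₚ-comm [] ys g = ≈ₚ-sym (Σₚ-0ₚ ys)
Σₚ-comm (x ∷ xs) ys g = ≈ₚ-trans (+ₚ-congˡ (Σₚ ys (g x)) (Σₚ-comm xs ys g))
  (≈ₚ-sym (Σₚ-+ₚ ys (g x) (λ b → Σₚ xs (λ a → g a b))))

Σₚ-allFin-suc : ∀ {m} (g : Fin (suc m) → Poly) →
                Σₚ (allFin (suc m)) g ≈ₚ g Fin.zero +ₚ Σₚ (allFin m) (g ∘ Fin.suc)
Σₚ-allFin-suc {m} g i = cong (g Fin.zero i +_) (cong (λ p → p i)
  (trans (cong (λ xs → Σₚ xs g) (sym (map-tabulate id Fin.suc)))
    (foldr-map (λ a acc → g a +ₚ acc) Fin.suc 0ₚ (allFin m))))

Σₚ-allFin-single : ∀ {m} (t : Fin m) (g : Fin m → Poly) →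
                   Σₚ (allFin m) (λ w → [ does (w Fin.≟ t) ]· g w) ≈ₚ g t
Σₚ-allFin-single {suc m} Fin.zero g = ≈ₚ-trans (Σₚ-allFin-suc (λ w → [ does (w Fin.≟ Fin.zero) ]· g w))
  (≈ₚ-trans (+ₚ-congˡ (g Fin.zero) (Σₚ-0ₚ (allFin m))) (+ₚ-identityʳ (g Fin.zero)))
Σₚ-allFin-single {suc m} (Fin.suc t) g = ≈ₚ-trans (Σₚ-allFin-suc (λ w → [ does (w Fin.≟ Fin.suc t) ]· g w))
  (≈ₚ-trans (+ₚ-identityˡ _) (Σₚ-allFin-single t (g ∘ Fin.suc)))

∑ : ∀ {m} → (Fin m → Poly) → Poly
∑ = Σₚ (allFin _)

infixr 5 ∑
syntax ∑ (λ w → e) = ∑[ w ] e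

∑-cong : ∀ {m} {f g : Fin m → Poly} → (∀ w → f w ≈ₚ g w) → ∑ f ≈ₚ ∑ g
∑-cong = Σₚ-cong (allFin _)

-- Subposets are given by lists of their elements (as Sub expects); this relates sums over
-- such a list to bracketed sums over all elements.
record _presents_ {m} (L : List (Fin m)) (p : Fin m → Bool) : Set where
  field Σₚ-presented : ∀ g → Σₚ L g ≈ₚ ∑[ w ] [ p w ]· g w

open _presents_ public

allFin-presents : ∀ {m} → allFin m presents (λ _ → true)
allFin-presents .Σₚ-presented g = ≈ₚ-refl

filterᵇ-presents : ∀ {m} (p : Fin m → Bool) → filterᵇ p (allFin m) presents p
filterᵇ-presents p .Σₚ-presented = Σₚ-filterᵇ (allFin _) p

Σₚ-filterᵇ-presented : ∀ {m} {L : List (Fin m)} {p} → L presents p → ∀ c g →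
                       Σₚ (filterᵇ c L) g ≈ₚ ∑[ w ] [ p w ∧ c w ]· g w
Σₚ-filterᵇ-presented {L = L} {p} L-presents c g = ≈ₚ-trans (Σₚ-filterᵇ L c g)
  (≈ₚ-trans (L-presents .Σₚ-presented (λ w → [ c w ]· g w)) (∑-cong λ w → []·-[]· (p w) (c w) (g w)))

monomial : ℕ → Poly
monomial k = revₚ k 1ₚ

geometric : ℕ → Poly
geometric k i = if suc i ≤ᵇ k then 1ℤ else 0ℤ

-- The power series −1 − x − x² − ⋯, the inverse of x − 1.
recipX-1 : Poly
recipX-1 _ = - 1ℤ

div-x-1≈*recipX-1 : ∀ p → div-x-1 p ≈ₚ p *ₚ recipX-1
div-x-1≈*recipX-1 p k = begin
  - sumℤ (map p (upTo (suc k)))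
    ≡⟨ cong (-_ ∘ sumℤ) (map-applyUpTo id p (suc k)) ⟩
  - sum< p (suc k)
    ≡⟨ sum<-neg p (suc k) ⟨
  sum< (λ i → - p i) (suc k)
    ≡⟨ *ₚ-as-sum<′ p recipX-1 k (λ i → trans (ℤ.*-comm (p i) (- 1ℤ)) (ℤ.-1*i≡-i (p i))) ⟨
  (p *ₚ recipX-1) k ∎
  where open ≡-Reasoning

private
  ≤ᵇ-suc : ∀ k i → (suc k ≤ᵇ suc i) ≡ (k ≤ᵇ i)
  ≤ᵇ-suc zero i = refl
  ≤ᵇ-suc (suc k) i = refl

  suc≤ᵇ≡not≤ᵇ : ∀ k i → (suc i ≤ᵇ k) ≡ not (k ≤ᵇ i)
  suc≤ᵇ≡not≤ᵇ zero i = refl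
  suc≤ᵇ≡not≤ᵇ (suc k) zero = refl
  suc≤ᵇ≡not≤ᵇ (suc k) (suc i) =
    trans (≤ᵇ-suc (suc i) k) (trans (suc≤ᵇ≡not≤ᵇ k i) (cong not (sym (≤ᵇ-suc k i))))

  sum<-monomial : ∀ k i → sum< (monomial k) (suc i) ≡ (if k ≤ᵇ i then 1ℤ else 0ℤ)
  sum<-monomial zero i = cong (1ℤ +_) (sum<-zero i)
  sum<-monomial (suc k) zero = refl
  sum<-monomial (suc k) (suc i) = trans (ℤ.+-identityˡ _)
    (trans (sum<-cong (suc i) (λ j → cong (λ b → if b then 1ₚ (k ∸ j) else 0ℤ) (≤ᵇ-suc j k)))
      (trans (sum<-monomial k i) (cong (λ b → if b then 1ℤ else 0ℤ) (sym (≤ᵇ-suc k i)))))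

[monomial-1]*recipX-1 : ∀ k → (monomial k +ₚ -ₚ 1ₚ) *ₚ recipX-1 ≈ₚ geometric k
[monomial-1]*recipX-1 k i = begin
  ((monomial k +ₚ -ₚ 1ₚ) *ₚ recipX-1) i
    ≡⟨ div-x-1≈*recipX-1 (monomial k +ₚ -ₚ 1ₚ) i ⟨
  - sumℤ (map (monomial k +ₚ -ₚ 1ₚ) (upTo (suc i)))
    ≡⟨ cong (-_ ∘ sumℤ) (map-applyUpTo id (monomial k +ₚ -ₚ 1ₚ) (suc i)) ⟩
  - sum< (monomial k +ₚ -ₚ 1ₚ) (suc i)
    ≡⟨ cong -_ (sum<-+ (monomial k) (-ₚ 1ₚ) (suc i)) ⟩
  - (sum< (monomial k) (suc i) + sum< (-ₚ 1ₚ) (suc i))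
    ≡⟨ cong₂ (λ a b → - (a + b)) (sum<-monomial k i)
         (trans (sum<-neg 1ₚ (suc i)) (cong (-_ ∘ (1ℤ +_)) (sum<-zero i))) ⟩
  - ((if k ≤ᵇ i then 1ℤ else 0ℤ) + - 1ℤ)
    ≡⟨ complement (k ≤ᵇ i) ⟩
  (if not (k ≤ᵇ i) then 1ℤ else 0ℤ)
    ≡⟨ cong (λ b → if b then 1ℤ else 0ℤ) (suc≤ᵇ≡not≤ᵇ k i) ⟨
  geometric k i ∎
  where
  open ≡-Reasoning
  complement : ∀ b → - ((if b then 1ℤ else 0ℤ) + - 1ℤ) ≡ (if not b then 1ℤ else 0ℤ)
  complement true = refl
  complement false = refl

geometric-suc : ∀ k → geometric (suc k) +ₚ -ₚ 1ₚ ≈ₚ Xₚ *ₚ geometric k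
geometric-suc k zero = sym (Xₚ-*ₚ-zero (geometric k))
geometric-suc k (suc i) = trans (ℤ.+-identityʳ _) (sym (Xₚ-*ₚ-suc (geometric k) i))

geometric-∸-self : ∀ m → geometric (m ∸ m) ≈ₚ 0ₚ
geometric-∸-self m i rewrite ℕ.n∸n≡0 m = refl

div-x-1-cong : ∀ {p q} → p ≈ₚ q → div-x-1 p ≈ₚ div-x-1 q
div-x-1-cong {p} {q} p≈q = ≈ₚ-trans (div-x-1≈*recipX-1 p)
  (≈ₚ-trans (*ₚ-congʳ recipX-1 p≈q) (≈ₚ-sym (div-x-1≈*recipX-1 q)))

geometric-∸-suc : ∀ {m k} → m < k → geometric (k ∸ m) +ₚ -ₚ 1ₚ ≈ₚ Xₚ *ₚ geometric (k ∸ m ∸ 1)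
geometric-∸-suc {zero} {suc k} _ = geometric-suc k
geometric-∸-suc {suc m} {suc k} (s≤s m<k) = geometric-∸-suc m<k

div-x-1-Σₚ-monomial : ∀ {A : Set} xs (m : A → Poly) (k : A → ℕ) → Σₚ xs m ≈ₚ 0ₚ →
  div-x-1 (Σₚ xs (λ u → m u *ₚ monomial (k u))) ≈ₚ Σₚ xs (λ u → m u *ₚ geometric (k u))
div-x-1-Σₚ-monomial xs m k Σm≈0 = begin
  div-x-1 (Σₚ xs (λ u → m u *ₚ monomial (k u)))
    ≈⟨ div-x-1≈*recipX-1 (Σₚ xs (λ u → m u *ₚ monomial (k u))) ⟩
  Σₚ xs (λ u → m u *ₚ monomial (k u)) *ₚ recipX-1
    ≈⟨ *ₚ-congʳ recipX-1 subtract-Σm ⟩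
  Σₚ xs (λ u → m u *ₚ (monomial (k u) +ₚ -ₚ 1ₚ)) *ₚ recipX-1
    ≈⟨ Σₚ-*ₚ xs recipX-1 (λ u → m u *ₚ (monomial (k u) +ₚ -ₚ 1ₚ)) ⟩
  Σₚ xs (λ u → m u *ₚ (monomial (k u) +ₚ -ₚ 1ₚ) *ₚ recipX-1)
    ≈⟨ Σₚ-cong xs (λ u → ≈ₚ-trans (*ₚ-assoc (m u) (monomial (k u) +ₚ -ₚ 1ₚ) recipX-1)
                                  (*ₚ-congˡ (m u) ([monomial-1]*recipX-1 (k u)))) ⟩
  Σₚ xs (λ u → m u *ₚ geometric (k u)) ∎
  where
  open ≈-Reasoning ≈ₚ-setoid
  subtract-Σm : Σₚ xs (λ u → m u *ₚ monomial (k u)) ≈ₚ Σₚ xs (λ u → m u *ₚ (monomial (k u) +ₚ -ₚ 1ₚ))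
  subtract-Σm = begin
    Σₚ xs (λ u → m u *ₚ monomial (k u))
      ≈⟨ +ₚ-identityʳ (Σₚ xs (λ u → m u *ₚ monomial (k u))) ⟨
    Σₚ xs (λ u → m u *ₚ monomial (k u)) +ₚ 0ₚ
      ≈⟨ +ₚ-congˡ (Σₚ xs (λ u → m u *ₚ monomial (k u))) (-ₚ-cong Σm≈0) ⟨
    Σₚ xs (λ u → m u *ₚ monomial (k u)) +ₚ -ₚ Σₚ xs m
      ≈⟨ +ₚ-congˡ (Σₚ xs (λ u → m u *ₚ monomial (k u))) (-ₚ-Σₚ xs m) ⟩
    Σₚ xs (λ u → m u *ₚ monomial (k u)) +ₚ Σₚ xs (λ u → -ₚ m u)
      ≈⟨ Σₚ-+ₚ xs (λ u → m u *ₚ monomial (k u)) (λ u → -ₚ m u) ⟨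
    Σₚ xs (λ u → m u *ₚ monomial (k u) +ₚ -ₚ m u)
      ≈⟨ Σₚ-cong xs (λ u → +ₚ-congˡ (m u *ₚ monomial (k u))
           (≈ₚ-trans (-ₚ-cong (≈ₚ-sym (*ₚ-identityʳ (m u)))) (≈ₚ-sym (*ₚ-negʳ (m u) 1ₚ)))) ⟩
    Σₚ xs (λ u → m u *ₚ monomial (k u) +ₚ m u *ₚ -ₚ 1ₚ)
      ≈⟨ Σₚ-cong xs (λ u → *ₚ-distribˡ-+ₚ (m u) (monomial (k u)) (-ₚ 1ₚ)) ⟨
    Σₚ xs (λ u → m u *ₚ (monomial (k u) +ₚ -ₚ 1ₚ)) ∎

∧-intro : ∀ {a b} → a ≡ true → b ≡ true → a ∧ b ≡ true
∧-intro refl refl = refl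

∧-elim : ∀ a {b} → a ∧ b ≡ true → a ≡ true × b ≡ true
∧-elim true e = refl , e

true⇔true⇒≡ : ∀ {a b} → (a ≡ true → b ≡ true) → (b ≡ true → a ≡ true) → a ≡ b
true⇔true⇒≡ {true} a⇒b _ = sym (a⇒b refl)
true⇔true⇒≡ {false} {true} _ b⇒a = b⇒a refl
true⇔true⇒≡ {false} {false} _ _ = refl

module _ {A : Set} where

  ∈-filterᵇ⁺ : ∀ (p : A → Bool) {xs x} → x ∈ xs → p x ≡ true → x ∈ filterᵇ p xs
  ∈-filterᵇ⁺ p m e = ∈-filter⁺ (T? ∘ p) m (Equivalence.from T-≡ e)

  ∈-filterᵇ⁻ : ∀ (p : A → Bool) {xs x} → x ∈ filterᵇ p xs → x ∈ xs × p x ≡ true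
  ∈-filterᵇ⁻ p m = map₂ (Equivalence.to T-≡) (∈-filter⁻ (T? ∘ p) m)

  length-filterᵇ-mono : ∀ (p p′ : A → Bool) xs → (∀ x → p x ≡ true → p′ x ≡ true) →
                        length (filterᵇ p xs) ≤ length (filterᵇ p′ xs)
  length-filterᵇ-mono p p′ [] _ = z≤n
  length-filterᵇ-mono p p′ (y ∷ xs) p⇒p′ with p y in e | p′ y in e′
  ... | true  | true  = s≤s (length-filterᵇ-mono p p′ xs p⇒p′)
  ... | true  | false with () ← trans (sym (p⇒p′ y e)) e′
  ... | false | true  = ℕ.m≤n⇒m≤1+n (length-filterᵇ-mono p p′ xs p⇒p′)
  ... | false | false = length-filterᵇ-mono p p′ xs p⇒p′

  length-filterᵇ-mono-< : ∀ (p p′ : A → Bool) xs {x} → (∀ x → p x ≡ true → p′ x ≡ true) →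
                          x ∈ xs → p′ x ≡ true → p x ≡ false →
                          length (filterᵇ p xs) < length (filterᵇ p′ xs)
  length-filterᵇ-mono-< p p′ (y ∷ xs) p⇒p′ (here refl) e′ e rewrite e | e′ =
    s≤s (length-filterᵇ-mono p p′ xs p⇒p′)
  length-filterᵇ-mono-< p p′ (y ∷ xs) p⇒p′ (there m) e′ e with p y in ey | p′ y in ey′
  ... | true  | true  = s≤s (length-filterᵇ-mono-< p p′ xs p⇒p′ m e′ e)
  ... | true  | false with () ← trans (sym (p⇒p′ y ey)) ey′
  ... | false | true  = ℕ.m≤n⇒m≤1+n (length-filterᵇ-mono-< p p′ xs p⇒p′ m e′ e)
  ... | false | false = length-filterᵇ-mono-< p p′ xs p⇒p′ m e′ e

  any-witness : ∀ (p : A → Bool) xs → any p xs ≡ true → ∃ λ x → p x ≡ true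
  any-witness p (y ∷ xs) e with p y in ey
  ... | true  = y , ey
  ... | false = any-witness p xs e

  any-false : ∀ (p : A → Bool) {xs x} → any p xs ≡ false → x ∈ xs → p x ≡ false
  any-false p {y ∷ xs} e (here refl) with p y
  ... | false = refl
  any-false p {y ∷ xs} e (there m) with p y
  ... | false = any-false p e m

  any-true : ∀ (p : A → Bool) {xs x} → x ∈ xs → p x ≡ true → any p xs ≡ true
  any-true p {y ∷ xs} (here refl) e rewrite e = refl
  any-true p {y ∷ xs} (there m) e with p y
  ... | true  = refl
  ... | false = any-true p m e

<-pred : ∀ {i j k} → i < j → j < suc k → i < k
<-pred i<j j<k = ℕ.<-≤-trans i<j (ℕ.≤-pred j<k)

module Order (P : GradedBoundedPoset) where
  open Incidence P

  ≼⇒leq : ∀ {s t} → s ≼ t → leq s t ≡ true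
  ≼⇒leq {s} {t} s≼t with s ≼? t
  ... | yes _ = refl
  ... | no s⋠t = ⊥-elim (s⋠t s≼t)

  leq⇒≼ : ∀ {s t} → leq s t ≡ true → s ≼ t
  leq⇒≼ {s} {t} e with s ≼? t
  ... | yes s≼t = s≼t

  ≡⇒eqb : ∀ {s t} → s ≡ t → eqb s t ≡ true
  ≡⇒eqb {s} {t} s≡t with s Fin.≟ t
  ... | yes _ = refl
  ... | no s≢t = ⊥-elim (s≢t s≡t)

  eqb⇒≡ : ∀ {s t} → eqb s t ≡ true → s ≡ t
  eqb⇒≡ {s} {t} e with s Fin.≟ t
  ... | yes s≡t = s≡t

  ≢⇒eqb-false : ∀ {s t} → s ≢ t → eqb s t ≡ false
  ≢⇒eqb-false s≢t = ¬-not (s≢t ∘ eqb⇒≡)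

  ≺⇒ltb : ∀ {s t} → s ≼ t → s ≢ t → ltb s t ≡ true
  ≺⇒ltb s≼t s≢t = ∧-intro (≼⇒leq s≼t) (cong not (≢⇒eqb-false s≢t))

  ltb⇒≼ : ∀ {s t} → ltb s t ≡ true → s ≼ t
  ltb⇒≼ {s} {t} e = leq⇒≼ (∧-conicalˡ (leq s t) _ e)

  ltb⇒≢ : ∀ {s t} → ltb s t ≡ true → s ≢ t
  ltb⇒≢ {s} {t} e s≡t = not-¬ (≡⇒eqb s≡t) (not-injective (∧-conicalʳ (leq s t) _ e))

  ltb-irrefl : ∀ t → ltb t t ≡ false
  ltb-irrefl t = ¬-not (λ e → ltb⇒≢ e refl)

  ≼-ltb-trans : ∀ {s t u} → s ≼ t → ltb t u ≡ true → ltb s u ≡ true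
  ≼-ltb-trans s≼t t<u = ≺⇒ltb (≼-trans s≼t (ltb⇒≼ t<u))
    (λ { refl → ltb⇒≢ t<u (≼-antisym (ltb⇒≼ t<u) s≼t) })

  ltb-trans : ∀ {s t u} → ltb s t ≡ true → ltb t u ≡ true → ltb s u ≡ true
  ltb-trans s<t = ≼-ltb-trans (ltb⇒≼ s<t)

  intervalSize : List (Fin n) → Fin n → Fin n → ℕ
  intervalSize L s t = length (filterᵇ (λ w → leq s w ∧ ltb w t) L)

  intervalSize-<ʳ : ∀ L {s w t} → w ∈ L → s ≼ w → ltb w t ≡ true →
                    intervalSize L s w < intervalSize L s t
  intervalSize-<ʳ L {s} {w} {t} w∈L s≼w w<t = length-filterᵇ-mono-<
    (λ y → leq s y ∧ ltb y w) (λ y → leq s y ∧ ltb y t) L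
    (λ y e → ∧-intro (∧-conicalˡ (leq s y) _ e) (ltb-trans (∧-conicalʳ (leq s y) _ e) w<t))
    w∈L (∧-intro (≼⇒leq s≼w) w<t)
    (¬-not (λ e → not-¬ (∧-conicalʳ (leq s w) _ e) (ltb-irrefl w)))

  intervalSize-<ˡ : ∀ L {s z t} → s ∈ L → ltb s z ≡ true → ltb s t ≡ true →
                    intervalSize L z t < intervalSize L s t
  intervalSize-<ˡ L {s} {z} {t} s∈L s<z s<t = length-filterᵇ-mono-<
    (λ y → leq z y ∧ ltb y t) (λ y → leq s y ∧ ltb y t) L
    (λ y e → ∧-intro (≼⇒leq (≼-trans (ltb⇒≼ s<z) (leq⇒≼ (∧-conicalˡ (leq z y) _ e))))
                     (∧-conicalʳ (leq z y) _ e))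
    s∈L (∧-intro (≼⇒leq ≼-refl) s<t)
    (¬-not (λ e → ltb⇒≢ s<z (≼-antisym (ltb⇒≼ s<z) (leq⇒≼ (∧-conicalˡ (leq z s) _ e)))))

  intervalSize-<-length : ∀ L {s t} → t ∈ L → intervalSize L s t < length L
  intervalSize-<-length L {s} {t} t∈L = filter-notAll (T? ∘ (λ w → leq s w ∧ ltb w t)) L
    (Any.map (λ { refl h → not-¬ (∧-conicalʳ (leq s t) _ (Equivalence.to T-≡ h)) (ltb-irrefl t) }) t∈L)

  nothing-between⇒cover : ∀ {s t} → any (λ z → ltb s z ∧ ltb z t) (allFin n) ≡ false →
                           ∀ w → s ≼ w → w ≼ t → w ≡ s ⊎ w ≡ t
  nothing-between⇒cover {s} {t} e w s≼w w≼t with w Fin.≟ s | w Fin.≟ t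
  ... | yes w≡s | _       = inj₁ w≡s
  ... | no _    | yes w≡t = inj₂ w≡t
  ... | no w≢s  | no w≢t  = ⊥-elim (not-¬
    (∧-intro (≺⇒ltb s≼w (w≢s ∘ sym)) (≺⇒ltb w≼t w≢t))
    (any-false (λ z → ltb s z ∧ ltb z t) e (∈-allFin w)))

  ρ-strictMono : ∀ {s t} → ltb s t ≡ true → ρ s < ρ t
  ρ-strictMono {s} {t} = go (suc (intervalSize (allFin n) s t)) ℕ.≤-refl
    where
    go : ∀ {s t} k → intervalSize (allFin n) s t < k → ltb s t ≡ true → ρ s < ρ t
    go {s} {t} (suc k) size<k s<t with any (λ z → ltb s z ∧ ltb z t) (allFin n) in e
    ... | false = ℕ.≤-reflexive (sym
          (ρ-cover (ltb⇒≼ s<t) (ltb⇒≢ s<t) (nothing-between⇒cover e)))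
    ... | true with z , s<z<t ← any-witness (λ z → ltb s z ∧ ltb z t) (allFin n) e =
      ℕ.<-trans (go k (<-pred (intervalSize-<ʳ (allFin n) (∈-allFin z) (ltb⇒≼ s<z) z<t) size<k) s<z)
                (go k (<-pred (intervalSize-<ˡ (allFin n) (∈-allFin s) s<z s<t) size<k) z<t)
      where
      s<z = ∧-conicalˡ (ltb s z) _ s<z<t
      z<t = ∧-conicalʳ (ltb s z) _ s<z<t

  ρ-positive : ∀ {t} → t ≢ bot → 0 < ρ t
  ρ-positive {t} t≢bot = subst (_< ρ t) ρ-bot (ρ-strictMono (≺⇒ltb (bot-min t) (t≢bot ∘ sym)))

  ∑-single : ∀ t (g : Fin n → Poly) → ∑[ w ] [ eqb w t ]· g w ≈ₚ g t
  ∑-single = Σₚ-allFin-single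

  ∑-split-top : ∀ (p c : Fin n → Bool) t (g : Fin n → Poly) → p t ≡ true → c t ≡ true →
    ∑[ w ] [ p w ∧ (c w ∧ leq w t) ]· g w ≈ₚ (∑[ w ] [ p w ∧ (c w ∧ ltb w t) ]· g w) +ₚ g t
  ∑-split-top p c t g pt ct = ≈ₚ-trans
    (∑-cong λ w → []·-partition (p w ∧ (c w ∧ leq w t)) (p w ∧ (c w ∧ ltb w t)) (eqb w t) (g w)
       (to-strict-or-top w) (from-strict w) (from-top w) (strict⇒not-top w))
    (≈ₚ-trans (Σₚ-+ₚ (allFin n) (λ w → [ p w ∧ (c w ∧ ltb w t) ]· g w) (λ w → [ eqb w t ]· g w))
              (+ₚ-congˡ (∑[ w ] [ p w ∧ (c w ∧ ltb w t) ]· g w) (∑-single t g)))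
    where
    to-strict-or-top : ∀ w → p w ∧ (c w ∧ leq w t) ≡ true →
                       p w ∧ (c w ∧ ltb w t) ≡ true ⊎ eqb w t ≡ true
    to-strict-or-top w e with eqb w t
    ... | true  = inj₂ refl
    ... | false = let pw , cw∧w≤t = ∧-elim (p w) e
                      cw , w≤t = ∧-elim (c w) cw∧w≤t
                  in inj₁ (∧-intro pw (∧-intro cw (∧-intro w≤t refl)))
    from-strict : ∀ w → p w ∧ (c w ∧ ltb w t) ≡ true → p w ∧ (c w ∧ leq w t) ≡ true
    from-strict w e = let pw , cw∧w<t = ∧-elim (p w) e
                          cw , w<t = ∧-elim (c w) cw∧w<t
                      in ∧-intro pw (∧-intro cw (≼⇒leq (ltb⇒≼ w<t)))
    from-top : ∀ w → eqb w t ≡ true → p w ∧ (c w ∧ leq w t) ≡ true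
    from-top w e = subst (λ x → p x ∧ (c x ∧ leq x t) ≡ true) (sym (eqb⇒≡ e))
                     (∧-intro pt (∧-intro ct (≼⇒leq ≼-refl)))
    strict⇒not-top : ∀ w → p w ∧ (c w ∧ ltb w t) ≡ true → eqb w t ≡ false
    strict⇒not-top w e = ≢⇒eqb-false (ltb⇒≢ (∧-conicalʳ (c w) _ (∧-conicalʳ (p w) _ e)))

module Subposet (P : GradedBoundedPoset) where
  open Incidence P
  open Order P

  module Inversion (L : List (Fin n)) (r : Fin n → ℕ) where
    open Sub L r

    private
      recursion-cong : ∀ a {k k′} s t →
        (∀ {w} → w ∈ L → s ≼ w → ltb w t ≡ true → invF k a s w ≈ₚ invF k′ a s w) →
        Σₚ (filterᵇ (λ w → leq s w ∧ ltb w t) L) (λ w → invF k a s w *ₚ a w t) ≈ₚ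
        Σₚ (filterᵇ (λ w → leq s w ∧ ltb w t) L) (λ w → invF k′ a s w *ₚ a w t)
      recursion-cong a s t e = Σₚ-cong-∈ (filterᵇ (λ w → leq s w ∧ ltb w t) L) λ {w} m →
        let w∈L , s≤w<t = ∈-filterᵇ⁻ (λ w → leq s w ∧ ltb w t) m
        in *ₚ-congʳ (a w t) (e w∈L (leq⇒≼ (∧-conicalˡ (leq s w) _ s≤w<t)) (∧-conicalʳ (leq s w) _ s≤w<t))

      ∈⇒length-suc : ∀ {t} → t ∈ L → ∃ λ k → length L ≡ suc k
      ∈⇒length-suc {t} = go L
        where
        go : ∀ xs → t ∈ xs → ∃ λ k → length xs ≡ suc k
        go (_ ∷ ys) _ = length ys , refl

    invF-stable : ∀ a k k′ s t → intervalSize L s t < k → intervalSize L s t < k′ →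
                  invF k a s t ≈ₚ invF k′ a s t
    invF-stable a (suc k) (suc k′) s t size<k size<k′ with eqb s t
    ... | true = ≈ₚ-refl
    ... | false = -ₚ-cong (*ₚ-congˡ (a t t) (recursion-cong a {k} {k′} s t λ {w} w∈L s≼w w<t →
      let smaller = intervalSize-<ʳ L w∈L s≼w w<t
      in invF-stable a k k′ s w (<-pred smaller size<k) (<-pred smaller size<k′)))

    inv-diag : ∀ a {t} → t ∈ L → inv a t t ≈ₚ a t t
    inv-diag a {t} t∈L with ∈⇒length-suc t∈L
    ... | k , eq rewrite eq | ≡⇒eqb {t} refl = ≈ₚ-refl

    inv-unfold : ∀ a {s t} → t ∈ L → s ≢ t →
      inv a s t ≈ₚ -ₚ (a t t *ₚ Σₚ (filterᵇ (λ w → leq s w ∧ ltb w t) L) (λ w → inv a s w *ₚ a w t))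
    inv-unfold a {s} {t} t∈L s≢t with intervalSize-<-length L {s} t∈L | ∈⇒length-suc t∈L
    ... | size<length | k , eq rewrite eq | ≢⇒eqb-false s≢t =
      -ₚ-cong (*ₚ-congˡ (a t t) (recursion-cong a {k} {suc k} s t λ {w} w∈L s≼w w<t →
        let smaller = intervalSize-<ʳ L w∈L s≼w w<t
        in invF-stable a k (suc k) s w (<-pred smaller size<length)
                                       (ℕ.<-trans smaller size<length)))

  module Algebra (L : List (Fin n)) (r : Fin n → ℕ) (p : Fin n → Bool) (L-presents : L presents p) where
    open Sub L r
    open Inversion L r

    μ-diag : ∀ {t} → t ∈ L → μ t t ≈ₚ 1ₚ
    μ-diag = inv-diag ζ

    μ-unfold : ∀ {s t} → t ∈ L → s ≢ t → μ s t ≈ₚ -ₚ (∑[ w ] [ p w ∧ (leq s w ∧ ltb w t) ]· μ s w)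
    μ-unfold {s} {t} t∈L s≢t = ≈ₚ-trans (inv-unfold ζ t∈L s≢t) (-ₚ-cong (≈ₚ-trans (*ₚ-identityˡ _)
      (≈ₚ-trans (Σₚ-filterᵇ-presented L-presents (λ w → leq s w ∧ ltb w t) (λ w → μ s w *ₚ 1ₚ))
        (∑-cong λ w → []·-cong (p w ∧ (leq s w ∧ ltb w t)) (λ _ → *ₚ-identityʳ (μ s w))))))

    μ-interval-sum : ∀ {s t} → t ∈ L → p t ≡ true → s ≼ t → s ≢ t →
                     ∑[ u ] [ p u ∧ (leq s u ∧ leq u t) ]· μ s u ≈ₚ 0ₚ
    μ-interval-sum {s} {t} t∈L pt s≼t s≢t =
      ≈ₚ-trans (∑-split-top p (leq s) t (μ s) pt (≼⇒leq s≼t))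
        (≈ₚ-trans (+ₚ-congˡ strict (μ-unfold t∈L s≢t)) (+ₚ-inverseʳ strict))
      where strict = ∑[ u ] [ p u ∧ (leq s u ∧ ltb u t) ]· μ s u

    χ-expand : ∀ s t → χ s t ≈ₚ ∑[ u ] [ p u ∧ (leq s u ∧ leq u t) ]· (μ s u *ₚ monomial (r t ∸ r u))
    χ-expand s t = Σₚ-filterᵇ-presented L-presents (λ u → leq s u ∧ leq u t)
                     (λ u → μ s u *ₚ monomial (r t ∸ r u))

    χbar-expand : ∀ {s t} → t ∈ L → p t ≡ true → s ≼ t → s ≢ t →
                  χbar s t ≈ₚ ∑[ u ] [ p u ∧ (leq s u ∧ leq u t) ]· (μ s u *ₚ geometric (r t ∸ r u))
    χbar-expand {s} {t} t∈L pt s≼t s≢t rewrite ≢⇒eqb-false s≢t = begin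
      div-x-1 (χ s t)
        ≈⟨ div-x-1-cong (≈ₚ-trans (χ-expand s t) (∑-cong λ u → ≈ₚ-sym ([]·-*ₚ (c u) (μ s u) (monomial (k u))))) ⟩
      div-x-1 (∑[ u ] [ c u ]· μ s u *ₚ monomial (k u))
        ≈⟨ div-x-1-Σₚ-monomial (allFin _) (λ u → [ c u ]· μ s u) k (μ-interval-sum t∈L pt s≼t s≢t) ⟩
      ∑[ u ] [ c u ]· μ s u *ₚ geometric (k u)
        ≈⟨ ∑-cong (λ u → []·-*ₚ (c u) (μ s u) (geometric (k u))) ⟩
      ∑[ u ] [ c u ]· (μ s u *ₚ geometric (k u)) ∎
      where
      open ≈-Reasoning ≈ₚ-setoid
      c = λ u → p u ∧ (leq s u ∧ leq u t)
      k = λ u → r t ∸ r u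

    χbar-diag : ∀ t → χbar t t ≈ₚ -ₚ 1ₚ
    χbar-diag t rewrite ≡⇒eqb {t} refl = ≈ₚ-refl

    H-diag : ∀ {t} → t ∈ L → H t t ≈ₚ 1ₚ
    H-diag {t} t∈L = ≈ₚ-trans (-ₚ-cong (≈ₚ-trans (inv-diag χbar t∈L) (χbar-diag t))) (-ₚ-involutive 1ₚ)

    H-unfold : ∀ {s v} → v ∈ L → s ≢ v → H s v ≈ₚ ∑[ w ] [ p w ∧ (leq s w ∧ ltb w v) ]· (H s w *ₚ χbar w v)
    H-unfold {s} {v} v∈L s≢v = begin
      -ₚ inv χbar s v
        ≈⟨ -ₚ-cong (inv-unfold χbar v∈L s≢v) ⟩
      -ₚ (-ₚ (χbar v v *ₚ strict))
        ≈⟨ -ₚ-involutive (χbar v v *ₚ strict) ⟩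
      χbar v v *ₚ strict
        ≈⟨ *ₚ-congʳ strict (χbar-diag v) ⟩
      (-ₚ 1ₚ) *ₚ strict
        ≈⟨ ≈ₚ-trans (*ₚ-negˡ 1ₚ strict) (-ₚ-cong (*ₚ-identityˡ strict)) ⟩
      -ₚ strict
        ≈⟨ -ₚ-cong (Σₚ-filterᵇ-presented L-presents (λ w → leq s w ∧ ltb w v) term) ⟩
      -ₚ (∑[ w ] [ c w ]· term w)
        ≈⟨ -ₚ-Σₚ (allFin _) (λ w → [ c w ]· term w) ⟩
      ∑[ w ] -ₚ ([ c w ]· term w)
        ≈⟨ ∑-cong (λ w → ≈ₚ-trans (≈ₚ-sym ([]·-negₚ (c w) (term w)))
                           ([]·-cong (c w) λ _ → ≈ₚ-sym (*ₚ-negˡ (inv χbar s w) (χbar w v)))) ⟩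
      ∑[ w ] [ c w ]· (H s w *ₚ χbar w v) ∎
      where
      open ≈-Reasoning ≈ₚ-setoid
      c = λ w → p w ∧ (leq s w ∧ ltb w v)
      term = λ w → inv χbar s w *ₚ χbar w v
      strict = Σₚ (filterᵇ (λ w → leq s w ∧ ltb w v) L) term

  module Locality
    (L : List (Fin n)) (r : Fin n → ℕ) (p : Fin n → Bool) (L-presents : L presents p)
    (D : Fin n → Set) (D-down : ∀ {y z} → D z → y ≼ z → D y)
    (D⇒∈ : ∀ {z} → D z → z ∈ L) (D⇒p : ∀ {z} → D z → p z ≡ true) (D⇒r≡ρ : ∀ {z} → D z → r z ≡ ρ z)
    where
    private
      module S = Sub L r
      module SA = Algebra L r p L-presents
      module PA = Algebra (allFin n) ρ (λ _ → true) allFin-presents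

      p-redundant : ∀ {y z} b → D z → (b ≡ true → y ≼ z) → p y ∧ b ≡ b
      p-redundant {y} b Dz b⇒y≼z = true⇔true⇒≡ (∧-conicalʳ (p y) _)
        (λ e → ∧-intro (D⇒p (D-down Dz (b⇒y≼z e))) e)

    invF-local : ∀ (a a′ : Inc) → (∀ {y z} → D z → y ≼ z → a y z ≈ₚ a′ y z) →
      ∀ k k′ {w z} → D z → intervalSize L w z < k → intervalSize (allFin n) w z < k′ →
      S.invF k a w z ≈ₚ Whole.invF k′ a′ w z
    invF-local a a′ a≈a′ (suc k) (suc k′) {w} {z} Dz size<k size<k′ with eqb w z
    ... | true = a≈a′ Dz ≼-refl
    ... | false = -ₚ-cong (*ₚ-cong (a≈a′ Dz ≼-refl) (begin
      Σₚ (filterᵇ c L) (λ y → S.invF k a w y *ₚ a y z)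
        ≈⟨ Σₚ-filterᵇ-presented L-presents c (λ y → S.invF k a w y *ₚ a y z) ⟩
      ∑[ y ] [ p y ∧ c y ]· (S.invF k a w y *ₚ a y z)
        ≈⟨ ∑-cong (λ y → []·-≡ (p-redundant (c y) Dz (ltb⇒≼ ∘ ∧-conicalʳ (leq w y) _)) (λ e →
             let w≤y , y<z = ∧-elim (leq w y) (∧-conicalʳ (p y) _ e)
                 Dy = D-down Dz (ltb⇒≼ y<z)
             in *ₚ-cong (invF-local a a′ a≈a′ k k′ Dy
                           (<-pred (intervalSize-<ʳ L (D⇒∈ Dy) (leq⇒≼ w≤y) y<z) size<k)
                           (<-pred (intervalSize-<ʳ (allFin n) (∈-allFin y) (leq⇒≼ w≤y) y<z) size<k′))
                        (a≈a′ Dz (ltb⇒≼ y<z)))) ⟩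
      ∑[ y ] [ c y ]· (Whole.invF k′ a′ w y *ₚ a′ y z)
        ≈⟨ Σₚ-filterᵇ (allFin n) c (λ y → Whole.invF k′ a′ w y *ₚ a′ y z) ⟨
      Σₚ (filterᵇ c (allFin n)) (λ y → Whole.invF k′ a′ w y *ₚ a′ y z) ∎))
      where
      open ≈-Reasoning ≈ₚ-setoid
      c = λ y → leq w y ∧ ltb y z

    inv-local : ∀ (a a′ : Inc) → (∀ {y z} → D z → y ≼ z → a y z ≈ₚ a′ y z) →
                ∀ {w z} → D z → S.inv a w z ≈ₚ Whole.inv a′ w z
    inv-local a a′ a≈a′ {w} {z} Dz = invF-local a a′ a≈a′ (length L) (length (allFin n)) Dz
      (intervalSize-<-length L (D⇒∈ Dz)) (intervalSize-<-length (allFin n) (∈-allFin z))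

    μ-local : ∀ {w z} → D z → S.μ w z ≈ₚ Whole.μ w z
    μ-local = inv-local ζ ζ (λ _ _ → ≈ₚ-refl)

    χ-local : ∀ {y z} → D z → S.χ y z ≈ₚ Whole.χ y z
    χ-local {y} {z} Dz = ≈ₚ-trans (SA.χ-expand y z) (≈ₚ-trans
      (∑-cong λ u → []·-≡ (p-redundant (leq y u ∧ leq u z) Dz (leq⇒≼ ∘ ∧-conicalʳ (leq y u) _)) λ e →
        let Du = D-down Dz (leq⇒≼ (∧-conicalʳ (leq y u) _ (∧-conicalʳ (p u) _ e)))
        in *ₚ-cong (μ-local Du) (λ i → cong (λ k → monomial k i) (cong₂ _∸_ (D⇒r≡ρ Dz) (D⇒r≡ρ Du))))
      (≈ₚ-sym (PA.χ-expand y z)))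

    χbar-local : ∀ {y z} → D z → S.χbar y z ≈ₚ Whole.χbar y z
    χbar-local {y} {z} Dz with eqb y z
    ... | true = ≈ₚ-refl
    ... | false = div-x-1-cong (χ-local Dz)

    H-local : ∀ {w z} → D z → S.H w z ≈ₚ Whole.H w z
    H-local Dz = -ₚ-cong (inv-local S.χbar Whole.χbar (λ {y} Dz′ _ → χbar-local {y} Dz′) Dz)

module IncidenceAlgebra (P : GradedBoundedPoset) where
  open Incidence P
  open Order P
  open Whole

  ·-expand : ∀ a b s t → (a · b) s t ≈ₚ ∑[ w ] [ leq s w ∧ leq w t ]· (a s w *ₚ b w t)
  ·-expand a b s t = Σₚ-filterᵇ (allFin n) (λ w → leq s w ∧ leq w t) (λ w → a s w *ₚ b w t)

  ·-congʳ : ∀ a b b′ s t → (∀ w → s ≼ w → w ≼ t → b w t ≈ₚ b′ w t) → (a · b) s t ≈ₚ (a · b′) s t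
  ·-congʳ a b b′ s t b≈b′ = Σₚ-cong-∈ (filterᵇ (λ w → leq s w ∧ leq w t) (allFin n)) λ {w} m →
    let _ , s≤w≤t = ∈-filterᵇ⁻ (λ w → leq s w ∧ leq w t) {allFin n} m
        s≤w , w≤t = ∧-elim (leq s w) s≤w≤t
    in *ₚ-congˡ (a s w) (b≈b′ w (leq⇒≼ s≤w) (leq⇒≼ w≤t))

  ·-bot-top : ∀ a b → (a · b) bot top ≈ₚ ∑[ w ] a bot w *ₚ b w top
  ·-bot-top a b = ≈ₚ-trans (·-expand a b bot top)
    (∑-cong λ w → []·-true (a bot w *ₚ b w top) (∧-intro (≼⇒leq (bot-min w)) (≼⇒leq (top-max w))))

  _·<_ : Inc → Inc → Inc
  (a ·< b) s t = ∑[ w ] [ leq s w ∧ ltb w t ]· (a s w *ₚ b w t)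

  ·-split-top : ∀ a b {s t} → s ≼ t → (a · b) s t ≈ₚ (a ·< b) s t +ₚ a s t *ₚ b t t
  ·-split-top a b {s} {t} s≼t = ≈ₚ-trans (·-expand a b s t)
    (∑-split-top (λ _ → true) (leq s) t (λ w → a s w *ₚ b w t) refl (≼⇒leq s≼t))

  ·-strict : ∀ a b {s t} → s ≼ t → b t t ≈ₚ 0ₚ → (a · b) s t ≈ₚ (a ·< b) s t
  ·-strict a b {s} {t} s≼t btt≈0 = ≈ₚ-trans (·-split-top a b s≼t)
    (≈ₚ-trans (+ₚ-congˡ ((a ·< b) s t) (≈ₚ-trans (*ₚ-congˡ (a s t) btt≈0) (*ₚ-zeroʳ (a s t))))
      (+ₚ-identityʳ ((a ·< b) s t)))

  ·-diag : ∀ a b t → (a · b) t t ≈ₚ a t t *ₚ b t t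
  ·-diag a b t = ≈ₚ-trans (·-expand a b t t)
    (≈ₚ-trans (∑-cong λ w → []·-≡ (true⇔true⇒≡ (≡⇒eqb ∘ squeeze w) (≼-both ∘ eqb⇒≡)) (λ _ → ≈ₚ-refl))
      (∑-single t (λ w → a t w *ₚ b w t)))
    where
    squeeze : ∀ w → leq t w ∧ leq w t ≡ true → w ≡ t
    squeeze w e = let t≤w , w≤t = ∧-elim (leq t w) e in ≼-antisym (leq⇒≼ w≤t) (leq⇒≼ t≤w)
    ≼-both : ∀ {w} → w ≡ t → leq t w ∧ leq w t ≡ true
    ≼-both refl = ∧-intro (≼⇒leq ≼-refl) (≼⇒leq ≼-refl)

  δ-diag : ∀ t → δ t t ≈ₚ 1ₚ
  δ-diag t rewrite ≡⇒eqb {t} refl = ≈ₚ-refl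

  δ-off-diag : ∀ {s t} → s ≢ t → δ s t ≈ₚ 0ₚ
  δ-off-diag s≢t rewrite ≢⇒eqb-false s≢t = ≈ₚ-refl

  ·-identityʳ : ∀ a {s t} → s ≼ t → (a · δ) s t ≈ₚ a s t
  ·-identityʳ a {s} {t} s≼t = ≈ₚ-trans (·-split-top a δ s≼t)
    (≈ₚ-trans (+ₚ-cong (Σₚ-zero (allFin n) (λ w → [ leq s w ∧ ltb w t ]· (a s w *ₚ δ w t)) strict-zero)
                       (*ₚ-congˡ (a s t) (δ-diag t)))
      (≈ₚ-trans (+ₚ-identityˡ (a s t *ₚ 1ₚ)) (*ₚ-identityʳ (a s t))))
    where
    strict-zero : ∀ w → [ leq s w ∧ ltb w t ]· (a s w *ₚ δ w t) ≈ₚ 0ₚ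
    strict-zero w = []·-zero (leq s w ∧ ltb w t) λ e →
      ≈ₚ-trans (*ₚ-congˡ (a s w) (δ-off-diag (ltb⇒≢ (∧-conicalʳ (leq s w) _ e)))) (*ₚ-zeroʳ (a s w))

  ·-assoc : ∀ a b c s t → ((a · b) · c) s t ≈ₚ (a · (b · c)) s t
  ·-assoc a b c s t = begin
    ((a · b) · c) s t
      ≈⟨ ·-expand (a · b) c s t ⟩
    ∑[ w ] [ leq s w ∧ leq w t ]· ((a · b) s w *ₚ c w t)
      ≈⟨ ∑-cong (λ w → []·-cong (leq s w ∧ leq w t) λ _ → *ₚ-congʳ (c w t) (·-expand a b s w)) ⟩
    ∑[ w ] [ leq s w ∧ leq w t ]· ((∑[ v ] [ leq s v ∧ leq v w ]· (a s v *ₚ b v w)) *ₚ c w t)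
      ≈⟨ ∑-cong (λ w → []·-Σₚ-*ₚ (allFin n) (leq s w ∧ leq w t) (λ v → leq s v ∧ leq v w)
                                 (λ v → a s v *ₚ b v w) (c w t)) ⟩
    ∑[ w ] ∑[ v ] [ (leq s w ∧ leq w t) ∧ (leq s v ∧ leq v w) ]· ((a s v *ₚ b v w) *ₚ c w t)
      ≈⟨ Σₚ-comm (allFin n) (allFin n)
           (λ w v → [ (leq s w ∧ leq w t) ∧ (leq s v ∧ leq v w) ]· ((a s v *ₚ b v w) *ₚ c w t)) ⟩
    ∑[ v ] ∑[ w ] [ (leq s w ∧ leq w t) ∧ (leq s v ∧ leq v w) ]· ((a s v *ₚ b v w) *ₚ c w t)
      ≈⟨ ∑-cong (λ v → ∑-cong λ w → []·-≡ (chain v w) λ _ → *ₚ-assoc (a s v) (b v w) (c w t)) ⟩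
    ∑[ v ] ∑[ w ] [ (leq s v ∧ leq v t) ∧ (leq v w ∧ leq w t) ]· (a s v *ₚ (b v w *ₚ c w t))
      ≈⟨ ∑-cong (λ v → []·-*ₚ-Σₚ (allFin n) (leq s v ∧ leq v t) (λ w → leq v w ∧ leq w t)
                                 (a s v) (λ w → b v w *ₚ c w t)) ⟨
    ∑[ v ] [ leq s v ∧ leq v t ]· (a s v *ₚ (∑[ w ] [ leq v w ∧ leq w t ]· (b v w *ₚ c w t)))
      ≈⟨ ∑-cong (λ v → []·-cong (leq s v ∧ leq v t) λ _ → *ₚ-congˡ (a s v) (·-expand b c v t)) ⟨
    ∑[ v ] [ leq s v ∧ leq v t ]· (a s v *ₚ (b · c) v t)
      ≈⟨ ·-expand a (b · c) s t ⟨
    (a · (b · c)) s t ∎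
    where
    open ≈-Reasoning ≈ₚ-setoid
    ≤-trans : ∀ {x y z} → leq x y ≡ true → leq y z ≡ true → leq x z ≡ true
    ≤-trans x≤y y≤z = ≼⇒leq (≼-trans (leq⇒≼ x≤y) (leq⇒≼ y≤z))
    chain : ∀ v w → (leq s w ∧ leq w t) ∧ (leq s v ∧ leq v w) ≡ (leq s v ∧ leq v t) ∧ (leq v w ∧ leq w t)
    chain v w = true⇔true⇒≡
      (λ e → let s≤w∧w≤t , s≤v∧v≤w = ∧-elim (leq s w ∧ leq w t) e
                 _ , w≤t = ∧-elim (leq s w) s≤w∧w≤t
                 s≤v , v≤w = ∧-elim (leq s v) s≤v∧v≤w
             in ∧-intro (∧-intro s≤v (≤-trans v≤w w≤t)) (∧-intro v≤w w≤t))
      (λ e → let s≤v∧v≤t , v≤w∧w≤t = ∧-elim (leq s v ∧ leq v t) e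
                 s≤v , _ = ∧-elim (leq s v) s≤v∧v≤t
                 v≤w , w≤t = ∧-elim (leq v w) v≤w∧w≤t
             in ∧-intro (∧-intro (≤-trans s≤v v≤w) w≤t) (∧-intro s≤v v≤w))

  ·-diag-zeroʳ : ∀ a b t → b t t ≈ₚ 0ₚ → (a · b) t t ≈ₚ 0ₚ
  ·-diag-zeroʳ a b t btt≈0 =
    ≈ₚ-trans (·-diag a b t) (≈ₚ-trans (*ₚ-congˡ (a t t) btt≈0) (*ₚ-zeroʳ (a t t)))

module HμRecursion (P : GradedBoundedPoset) where
  open Incidence P
  open Order P
  open Whole
  open IncidenceAlgebra P
  open Subposet.Algebra P (allFin n) ρ (λ _ → true) allFin-presents

  Hμ : Inc
  Hμ = H · μ

  β β′ : Inc
  β s t = geometric (ρ t ∸ ρ s)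
  β′ s t = geometric (ρ t ∸ ρ s ∸ 1)

  β-diag : ∀ t → β t t ≈ₚ 0ₚ
  β-diag t = geometric-∸-self (ρ t)

  β′-diag : ∀ t → β′ t t ≈ₚ 0ₚ
  β′-diag t rewrite ℕ.n∸n≡0 (ρ t) = ≈ₚ-refl

  β-1≈Xβ′ : ∀ {s t} → ltb s t ≡ true → β s t +ₚ -ₚ 1ₚ ≈ₚ Xₚ *ₚ β′ s t
  β-1≈Xβ′ s<t = geometric-∸-suc (ρ-strictMono s<t)

  μ·ζ≈δ : ∀ {s t} → s ≼ t → (μ · ζ) s t ≈ₚ δ s t
  μ·ζ≈δ {s} {t} s≼t with s Fin.≟ t
  ... | yes refl = ≈ₚ-trans (·-diag μ ζ t)
    (≈ₚ-trans (*ₚ-identityʳ (μ t t)) (μ-diag (∈-allFin t)))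
  ... | no s≢t = ≈ₚ-trans (·-expand μ ζ s t)
    (≈ₚ-trans (∑-cong λ u → []·-cong (leq s u ∧ leq u t) λ _ → *ₚ-identityʳ (μ s u))
      (μ-interval-sum (∈-allFin t) refl s≼t s≢t))

  H≈Hμ·ζ : ∀ v → H bot v ≈ₚ (Hμ · ζ) bot v
  H≈Hμ·ζ v = ≈ₚ-sym (begin
    (Hμ · ζ) bot v      ≈⟨ ·-assoc H μ ζ bot v ⟩
    (H · (μ · ζ)) bot v ≈⟨ ·-congʳ H (μ · ζ) δ bot v (λ w _ w≼v → μ·ζ≈δ w≼v) ⟩
    (H · δ) bot v       ≈⟨ ·-identityʳ H (bot-min v) ⟩
    H bot v             ∎)
    where open ≈-Reasoning ≈ₚ-setoid

  χbar≈μ·β : ∀ {s t} → ltb s t ≡ true → χbar s t ≈ₚ (μ · β) s t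
  χbar≈μ·β {s} {t} s<t = ≈ₚ-trans (χbar-expand (∈-allFin t) refl (ltb⇒≼ s<t) (ltb⇒≢ s<t))
    (≈ₚ-sym (·-expand μ β s t))

  H≈Hμ·β : ∀ {v} → v ≢ bot → H bot v ≈ₚ (Hμ · β) bot v
  H≈Hμ·β {v} v≢bot = begin
    H bot v
      ≈⟨ H-unfold (∈-allFin v) (v≢bot ∘ sym) ⟩
    (H ·< χbar) bot v
      ≈⟨ ∑-cong (λ w → []·-cong (leq bot w ∧ ltb w v) λ e →
           *ₚ-congˡ (H bot w) (χbar≈μ·β (∧-conicalʳ (leq bot w) _ e))) ⟩
    (H ·< (μ · β)) bot v
      ≈⟨ ·-strict H (μ · β) (bot-min v) (·-diag-zeroʳ μ β v (β-diag v)) ⟨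
    (H · (μ · β)) bot v
      ≈⟨ ·-assoc H μ β bot v ⟨
    (Hμ · β) bot v ∎
    where open ≈-Reasoning ≈ₚ-setoid

  ·<β-·<ζ≈Xₚ*·<β′ : ∀ a s t → (a ·< β) s t +ₚ -ₚ (a ·< ζ) s t ≈ₚ Xₚ *ₚ (a ·< β′) s t
  ·<β-·<ζ≈Xₚ*·<β′ a s t = begin
    (a ·< β) s t +ₚ -ₚ (a ·< ζ) s t
      ≈⟨ +ₚ-congˡ ((a ·< β) s t) (-ₚ-Σₚ (allFin n) (λ u → [ c u ]· (a s u *ₚ 1ₚ))) ⟩
    (a ·< β) s t +ₚ (∑[ u ] -ₚ ([ c u ]· (a s u *ₚ 1ₚ)))
      ≈⟨ Σₚ-+ₚ (allFin n) (λ u → [ c u ]· (a s u *ₚ β u t)) (λ u → -ₚ ([ c u ]· (a s u *ₚ 1ₚ))) ⟨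
    ∑[ u ] [ c u ]· (a s u *ₚ β u t) +ₚ -ₚ ([ c u ]· (a s u *ₚ 1ₚ))
      ≈⟨ ∑-cong termwise ⟩
    ∑[ u ] Xₚ *ₚ [ c u ]· (a s u *ₚ β′ u t)
      ≈⟨ *ₚ-Σₚ (allFin n) Xₚ (λ u → [ c u ]· (a s u *ₚ β′ u t)) ⟨
    Xₚ *ₚ (a ·< β′) s t ∎
    where
    open ≈-Reasoning ≈ₚ-setoid
    c = λ u → leq s u ∧ ltb u t
    termwise : ∀ u → [ c u ]· (a s u *ₚ β u t) +ₚ -ₚ ([ c u ]· (a s u *ₚ 1ₚ)) ≈ₚ
                     Xₚ *ₚ [ c u ]· (a s u *ₚ β′ u t)
    termwise u = begin
      [ c u ]· (a s u *ₚ β u t) +ₚ -ₚ ([ c u ]· (a s u *ₚ 1ₚ))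
        ≈⟨ +ₚ-congˡ ([ c u ]· (a s u *ₚ β u t)) ([]·-negₚ (c u) (a s u *ₚ 1ₚ)) ⟨
      [ c u ]· (a s u *ₚ β u t) +ₚ [ c u ]· (-ₚ (a s u *ₚ 1ₚ))
        ≈⟨ []·-+ₚ (c u) (a s u *ₚ β u t) (-ₚ (a s u *ₚ 1ₚ)) ⟨
      [ c u ]· (a s u *ₚ β u t +ₚ -ₚ (a s u *ₚ 1ₚ))
        ≈⟨ []·-cong (c u) (λ e → ≈ₚ-trans (*ₚ-+ₚ-1 (a s u) (β u t))
             (≈ₚ-trans (*ₚ-congˡ (a s u) (β-1≈Xβ′ (∧-conicalʳ (leq s u) _ e)))
               (*ₚ-Xₚ-swap (a s u) (β′ u t)))) ⟩
      [ c u ]· (Xₚ *ₚ (a s u *ₚ β′ u t))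
        ≈⟨ *ₚ-[]· (c u) Xₚ (a s u *ₚ β′ u t) ⟨
      Xₚ *ₚ [ c u ]· (a s u *ₚ β′ u t) ∎

  Hμ-recursion : ∀ {t} → t ≢ bot → Hμ bot t ≈ₚ Xₚ *ₚ (Hμ · β′) bot t
  Hμ-recursion {t} t≢bot = begin
    Hμ bot t                                  ≈⟨ +ₚ-cancelˡ top-term ⟩
    (Hμ ·< β) bot t +ₚ -ₚ (Hμ ·< ζ) bot t     ≈⟨ ·<β-·<ζ≈Xₚ*·<β′ Hμ bot t ⟩
    Xₚ *ₚ (Hμ ·< β′) bot t                    ≈⟨ *ₚ-congˡ Xₚ (·-strict Hμ β′ (bot-min t) (β′-diag t)) ⟨
    Xₚ *ₚ (Hμ · β′) bot t                     ∎
    where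
    open ≈-Reasoning ≈ₚ-setoid
    top-term : (Hμ ·< ζ) bot t +ₚ Hμ bot t ≈ₚ (Hμ ·< β) bot t
    top-term = begin
      (Hμ ·< ζ) bot t +ₚ Hμ bot t           ≈⟨ +ₚ-congˡ ((Hμ ·< ζ) bot t) (*ₚ-identityʳ (Hμ bot t)) ⟨
      (Hμ ·< ζ) bot t +ₚ Hμ bot t *ₚ ζ t t  ≈⟨ ·-split-top Hμ ζ (bot-min t) ⟨
      (Hμ · ζ) bot t                        ≈⟨ H≈Hμ·ζ t ⟨
      H bot t                               ≈⟨ H≈Hμ·β t≢bot ⟩
      (Hμ · β) bot t                        ≈⟨ ·-strict Hμ β (bot-min t) (β-diag t) ⟩
      (Hμ ·< β) bot t                       ∎

module Truncation (P : GradedBoundedPoset) (t : Fin (GradedBoundedPoset.n P))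
                  (bot≢t : GradedBoundedPoset.bot P ≢ t) where
  open Incidence P
  open Order P
  open Whole
  open IncidenceAlgebra P
  open HμRecursion P

  q : Fin n → Bool
  q w = leq w t ∧ not (covb w t)

  private
    module T = Sub (truncElems t) (truncRank t)
    module TA = Subposet.Algebra P (truncElems t) (truncRank t) q (filterᵇ-presents q)

  Below : Fin n → Set
  Below z = q z ≡ true × z ≢ t

  Below-down : ∀ {y z} → Below z → y ≼ z → Below y
  Below-down {y} {z} (qz , z≢t) y≼z = qy , y≢t
    where
    z≼t = leq⇒≼ (∧-conicalˡ (leq z t) _ qz)
    y≢t : y ≢ t
    y≢t refl = z≢t (≼-antisym z≼t y≼z)
    qy : q y ≡ true
    qy with y Fin.≟ z
    ... | yes refl = qz
    ... | no y≢z = ∧-intro (≼⇒leq (≼-trans y≼z z≼t)) (cong not (trans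
      (cong (λ b → ltb y t ∧ not b) (any-true (λ x → ltb y x ∧ ltb x t) (∈-allFin z)
        (∧-intro (≺⇒ltb y≼z y≢z) (≺⇒ltb z≼t z≢t))))
      (∧-zeroʳ (ltb y t))))

  truncRank-below : ∀ {z} → z ≢ t → truncRank t z ≡ ρ z
  truncRank-below {z} z≢t = cong (λ b → if b then ρ t ∸ 1 else ρ z) (≢⇒eqb-false z≢t)

  truncRank-top : truncRank t t ≡ ρ t ∸ 1
  truncRank-top = cong (λ b → if b then ρ t ∸ 1 else ρ t) (≡⇒eqb {t} refl)

  Below⇒∈ : ∀ {z} → Below z → z ∈ truncElems t
  Below⇒∈ {z} (qz , _) = ∈-filterᵇ⁺ q (∈-allFin z) qz

  open Subposet.Locality P (truncElems t) (truncRank t) q (filterᵇ-presents q)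
    Below Below-down Below⇒∈ proj₁ (truncRank-below ∘ proj₂)

  q-top : q t ≡ true
  q-top = ∧-intro (≼⇒leq ≼-refl)
    (cong (λ b → not (b ∧ not (any (λ z → ltb t z ∧ ltb z t) (allFin n)))) (ltb-irrefl t))

  t∈trunc : t ∈ truncElems t
  t∈trunc = ∈-filterᵇ⁺ q (∈-allFin t) q-top

  coatom⇒cover : ∀ {w} → covb w t ≡ true → ∀ u → w ≼ u → u ≼ t → u ≡ w ⊎ u ≡ t
  coatom⇒cover {w} e = nothing-between⇒cover (not-injective (∧-conicalʳ (ltb w t) _ e))

  coatom-rank : ∀ {w} → covb w t ≡ true → ρ t ≡ suc (ρ w)
  coatom-rank {w} e = let w<t = ∧-conicalˡ (ltb w t) _ e in
    ρ-cover (ltb⇒≼ w<t) (ltb⇒≢ w<t) (coatom⇒cover e)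

  β′-coatom : ∀ {w} → covb w t ≡ true → β′ w t ≈ₚ 0ₚ
  β′-coatom {w} e i rewrite coatom-rank e | ℕ.m+n∸n≡m 1 (ρ w) = refl

  coatom-up : ∀ {w u} → covb w t ≡ true → w ≼ u → ltb u t ≡ true → covb u t ≡ true
  coatom-up {w} {u} e w≼u u<t with coatom⇒cover e u w≼u (ltb⇒≼ u<t)
  ... | inj₁ refl = e
  ... | inj₂ refl = ⊥-elim (ltb⇒≢ u<t refl)

  μ·β′-coatom : ∀ {w} → covb w t ≡ true → (μ · β′) w t ≈ₚ 0ₚ
  μ·β′-coatom {w} e = ≈ₚ-trans (·-strict μ β′ (ltb⇒≼ (∧-conicalˡ (ltb w t) _ e)) (β′-diag t))
    (Σₚ-zero (allFin n) (λ u → [ leq w u ∧ ltb u t ]· (μ w u *ₚ β′ u t)) λ u →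
      []·-zero (leq w u ∧ ltb u t) λ e′ → let w≤u , u<t = ∧-elim (leq w u) e′ in
        ≈ₚ-trans (*ₚ-congˡ (μ w u) (β′-coatom (coatom-up e (leq⇒≼ w≤u) u<t))) (*ₚ-zeroʳ (μ w u)))

  not-q⇒coatom : ∀ {u} → q u ≡ false → ltb u t ≡ true → covb u t ≡ true
  not-q⇒coatom {u} ¬qu u<t with covb u t
  ... | true = refl
  ... | false = ⊥-elim (not-¬ (∧-intro (≼⇒leq (ltb⇒≼ u<t)) refl) ¬qu)

  drop-q : ∀ (c : Fin n → Bool) (g : Fin n → Poly) → (∀ {u} → c u ≡ true → ltb u t ≡ true) →
           (∀ {u} → covb u t ≡ true → g u ≈ₚ 0ₚ) → ∑[ u ] [ q u ∧ c u ]· g u ≈ₚ ∑[ u ] [ c u ]· g u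
  drop-q c g c⇒<t vanish = ∑-cong pointwise
    where
    pointwise : ∀ u → [ q u ∧ c u ]· g u ≈ₚ [ c u ]· g u
    pointwise u with q u in e
    ... | true = ≈ₚ-refl
    ... | false = ≈ₚ-sym ([]·-zero (c u) λ cu → vanish (not-q⇒coatom e (c⇒<t cu)))

  χbar-trunc : ∀ {w} → q w ≡ true → ltb w t ≡ true → T.χbar w t ≈ₚ (μ · β′) w t
  χbar-trunc {w} qw w<t = begin
    T.χbar w t
      ≈⟨ TA.χbar-expand t∈trunc q-top (ltb⇒≼ w<t) (ltb⇒≢ w<t) ⟩
    ∑[ u ] [ q u ∧ (leq w u ∧ leq u t) ]· (T.μ w u *ₚ geometric (r t ∸ r u))
      ≈⟨ ∑-split-top q (leq w) t (λ u → T.μ w u *ₚ geometric (r t ∸ r u)) q-top (≼⇒leq (ltb⇒≼ w<t)) ⟩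
    (∑[ u ] [ q u ∧ (leq w u ∧ ltb u t) ]· (T.μ w u *ₚ geometric (r t ∸ r u)))
      +ₚ T.μ w t *ₚ geometric (r t ∸ r t)
      ≈⟨ +ₚ-cong (∑-cong λ u → []·-cong (q u ∧ (leq w u ∧ ltb u t)) (agrees-below u))
                 (≈ₚ-trans (*ₚ-congˡ (T.μ w t) (geometric-∸-self (r t))) (*ₚ-zeroʳ (T.μ w t))) ⟩
    (∑[ u ] [ q u ∧ (leq w u ∧ ltb u t) ]· (μ w u *ₚ β′ u t)) +ₚ 0ₚ
      ≈⟨ +ₚ-identityʳ (∑[ u ] [ q u ∧ (leq w u ∧ ltb u t) ]· (μ w u *ₚ β′ u t)) ⟩
    ∑[ u ] [ q u ∧ (leq w u ∧ ltb u t) ]· (μ w u *ₚ β′ u t)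
      ≈⟨ drop-q (λ u → leq w u ∧ ltb u t) (λ u → μ w u *ₚ β′ u t) (∧-conicalʳ (leq w _) _)
           (λ {u} cov → ≈ₚ-trans (*ₚ-congˡ (μ w u) (β′-coatom cov)) (*ₚ-zeroʳ (μ w u))) ⟩
    (μ ·< β′) w t
      ≈⟨ ·-strict μ β′ (ltb⇒≼ w<t) (β′-diag t) ⟨
    (μ · β′) w t ∎
    where
    open ≈-Reasoning ≈ₚ-setoid
    r = truncRank t
    agrees-below : ∀ u → q u ∧ (leq w u ∧ ltb u t) ≡ true →
                   T.μ w u *ₚ geometric (r t ∸ r u) ≈ₚ μ w u *ₚ β′ u t
    agrees-below u e = *ₚ-cong (μ-local (qu , u≢t)) (λ i → cong (λ k → geometric k i) rank-shift)
      where
      qu = ∧-conicalˡ (q u) _ e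
      u≢t = ltb⇒≢ (∧-conicalʳ (leq w u) _ (∧-conicalʳ (q u) _ e))
      rank-shift : r t ∸ r u ≡ ρ t ∸ ρ u ∸ 1
      rank-shift = trans (cong₂ _∸_ truncRank-top (truncRank-below u≢t))
        (trans (ℕ.∸-+-assoc (ρ t) 1 (ρ u))
          (trans (cong (ρ t ∸_) (ℕ.+-comm 1 (ρ u))) (sym (ℕ.∸-+-assoc (ρ t) (ρ u) 1))))

  Htrunc≈Hμ·β′ : Htrunc t ≈ₚ (Hμ · β′) bot t
  Htrunc≈Hμ·β′ = begin
    Htrunc t
      ≈⟨ TA.H-unfold t∈trunc bot≢t ⟩
    ∑[ w ] [ q w ∧ (leq bot w ∧ ltb w t) ]· (T.H bot w *ₚ T.χbar w t)
      ≈⟨ ∑-cong (λ w → []·-cong (q w ∧ (leq bot w ∧ ltb w t)) λ e →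
           let qw = ∧-conicalˡ (q w) _ e
               w<t = ∧-conicalʳ (leq bot w) _ (∧-conicalʳ (q w) _ e)
           in *ₚ-cong (H-local (qw , ltb⇒≢ w<t)) (χbar-trunc qw w<t)) ⟩
    ∑[ w ] [ q w ∧ (leq bot w ∧ ltb w t) ]· (H bot w *ₚ (μ · β′) w t)
      ≈⟨ drop-q (λ w → leq bot w ∧ ltb w t) (λ w → H bot w *ₚ (μ · β′) w t) (∧-conicalʳ (leq bot _) _)
           (λ {w} cov → ≈ₚ-trans (*ₚ-congˡ (H bot w) (μ·β′-coatom cov)) (*ₚ-zeroʳ (H bot w))) ⟩
    (H ·< (μ · β′)) bot t
      ≈⟨ ·-strict H (μ · β′) (bot-min t) (·-diag-zeroʳ μ β′ t (β′-diag t)) ⟨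
    (H · (μ · β′)) bot t
      ≈⟨ ·-assoc H μ β′ bot t ⟨
    (Hμ · β′) bot t ∎
    where open ≈-Reasoning ≈ₚ-setoid

module AugmentedChow (P : GradedBoundedPoset) where
  open Incidence P
  open Order P
  open Whole
  open IncidenceAlgebra P
  open HμRecursion P
  open Subposet.Algebra P (allFin n) ρ (λ _ → true) allFin-presents

  Hμ-bot : Hμ bot bot ≈ₚ 1ₚ
  Hμ-bot = ≈ₚ-trans (·-diag H μ bot)
    (≈ₚ-trans (*ₚ-cong (H-diag (∈-allFin bot)) (μ-diag (∈-allFin bot))) (*ₚ-identityˡ 1ₚ))

  Hμ-atom : ∀ {t} → ρ t ≡ 1 → Hμ bot t ≈ₚ 0ₚ
  Hμ-atom {t} ρt≡1 = ≈ₚ-trans (Hμ-recursion t≢bot)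
    (≈ₚ-trans (*ₚ-congˡ Xₚ (≈ₚ-trans (·-expand Hμ β′ bot t)
      (Σₚ-zero (allFin n) (λ u → [ leq bot u ∧ leq u t ]· (Hμ bot u *ₚ β′ u t)) λ u →
        []·-zero (leq bot u ∧ leq u t) λ _ →
          ≈ₚ-trans (*ₚ-congˡ (Hμ bot u) (β′-vanishes u)) (*ₚ-zeroʳ (Hμ bot u)))))
      (*ₚ-zeroʳ Xₚ))
    where
    t≢bot : t ≢ bot
    t≢bot refl with () ← trans (sym ρ-bot) ρt≡1
    β′-vanishes : ∀ u → β′ u t ≈ₚ 0ₚ
    β′-vanishes u i rewrite ρt≡1 with ρ u
    ... | zero = refl
    ... | suc k rewrite ℕ.0∸n≡0 k = refl

  Hμ-high : ∀ {t} → 2 ≤ ρ t → Hμ bot t ≈ₚ Xₚ *ₚ Htrunc t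
  Hμ-high {t} 2≤ρt = ≈ₚ-trans (Hμ-recursion t≢bot)
    (*ₚ-congˡ Xₚ (≈ₚ-sym (Truncation.Htrunc≈Hμ·β′ P t (t≢bot ∘ sym))))
    where
    t≢bot : t ≢ bot
    t≢bot refl with () ← subst (2 ≤_) ρ-bot 2≤ρt

  Hμ-values : ∀ w → Hμ bot w ≈ₚ [ eqb w bot ]· 1ₚ +ₚ [ 2 ≤ᵇ ρ w ]· (Xₚ *ₚ Htrunc w)
  Hμ-values w with w Fin.≟ bot
  ... | yes refl = ≈ₚ-trans Hμ-bot (≈ₚ-sym (≈ₚ-trans
          (+ₚ-congˡ 1ₚ ([]·-≡ (cong (2 ≤ᵇ_) ρ-bot) (λ _ → ≈ₚ-refl))) (+ₚ-identityʳ 1ₚ)))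
  ... | no w≢bot = by-rank (ρ w) refl (ρ-positive w≢bot)
    where
    by-rank : ∀ k → ρ w ≡ k → 0 < k → Hμ bot w ≈ₚ 0ₚ +ₚ [ 2 ≤ᵇ ρ w ]· (Xₚ *ₚ Htrunc w)
    by-rank 1 ρw≡1 _ = ≈ₚ-trans (Hμ-atom ρw≡1) (≈ₚ-sym (≈ₚ-trans
      (+ₚ-congˡ 0ₚ ([]·-≡ (cong (2 ≤ᵇ_) ρw≡1) (λ _ → ≈ₚ-refl))) (+ₚ-identityˡ 0ₚ)))
    by-rank (suc (suc k)) ρw≡2+k _ = ≈ₚ-trans (Hμ-high (subst (2 ≤_) (sym ρw≡2+k) (s≤s (s≤s z≤n))))
      (≈ₚ-sym (≈ₚ-trans (+ₚ-congˡ 0ₚ ([]·-true (Xₚ *ₚ Htrunc w) (cong (2 ≤ᵇ_) ρw≡2+k)))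
                        (+ₚ-identityˡ (Xₚ *ₚ Htrunc w))))

  F≈Hμ·Z : ∀ f → IsRightKLS f → F f bot top ≈ₚ (Hμ · Z f) bot top
  F≈Hμ·Z f kls = begin
    (H · rev f) bot top        ≈⟨ ·-congʳ H (rev f) (χ · f) bot top (λ w _ _ → rev≡ w top (top-max w)) ⟩
    (H · (χ · f)) bot top      ≈⟨ ·-congʳ H (χ · f) (μ · Z f) bot top (λ w _ _ → ·-assoc μ (rev ζ) f w top) ⟩
    (H · (μ · Z f)) bot top    ≈⟨ ·-assoc H μ (Z f) bot top ⟨
    (Hμ · Z f) bot top         ∎
    where
    open ≈-Reasoning ≈ₚ-setoid
    open IsRightKLS kls

  ∑-Hμ-values : ∀ (g : Fin n → Poly) →
    ∑[ w ] ([ eqb w bot ]· 1ₚ +ₚ [ 2 ≤ᵇ ρ w ]· (Xₚ *ₚ Htrunc w)) *ₚ g w ≈ₚ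
    g bot +ₚ Xₚ *ₚ Σₚ rankAbove1 (λ w → Htrunc w *ₚ g w)
  ∑-Hμ-values g = begin
    ∑[ w ] ([ eqb w bot ]· 1ₚ +ₚ [ 2 ≤ᵇ ρ w ]· (Xₚ *ₚ Htrunc w)) *ₚ g w
      ≈⟨ ∑-cong (λ w → *ₚ-distribʳ-+ₚ ([ eqb w bot ]· 1ₚ) ([ 2 ≤ᵇ ρ w ]· (Xₚ *ₚ Htrunc w)) (g w)) ⟩
    ∑[ w ] [ eqb w bot ]· 1ₚ *ₚ g w +ₚ [ 2 ≤ᵇ ρ w ]· (Xₚ *ₚ Htrunc w) *ₚ g w
      ≈⟨ Σₚ-+ₚ (allFin n) (λ w → [ eqb w bot ]· 1ₚ *ₚ g w) (λ w → [ 2 ≤ᵇ ρ w ]· (Xₚ *ₚ Htrunc w) *ₚ g w) ⟩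
    (∑[ w ] [ eqb w bot ]· 1ₚ *ₚ g w) +ₚ (∑[ w ] [ 2 ≤ᵇ ρ w ]· (Xₚ *ₚ Htrunc w) *ₚ g w)
      ≈⟨ +ₚ-cong (≈ₚ-trans (∑-cong λ w → ≈ₚ-trans ([]·-*ₚ (eqb w bot) 1ₚ (g w))
                                                  ([]·-cong (eqb w bot) λ _ → *ₚ-identityˡ (g w)))
                           (∑-single bot g))
                 (∑-cong λ w → ≈ₚ-trans ([]·-*ₚ (2 ≤ᵇ ρ w) (Xₚ *ₚ Htrunc w) (g w))
                   (≈ₚ-trans ([]·-cong (2 ≤ᵇ ρ w) λ _ → *ₚ-assoc Xₚ (Htrunc w) (g w))
                     (≈ₚ-sym (*ₚ-[]· (2 ≤ᵇ ρ w) Xₚ (Htrunc w *ₚ g w))))) ⟩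
    g bot +ₚ (∑[ w ] Xₚ *ₚ [ 2 ≤ᵇ ρ w ]· (Htrunc w *ₚ g w))
      ≈⟨ +ₚ-congˡ (g bot) (*ₚ-Σₚ (allFin n) Xₚ (λ w → [ 2 ≤ᵇ ρ w ]· (Htrunc w *ₚ g w))) ⟨
    g bot +ₚ Xₚ *ₚ (∑[ w ] [ 2 ≤ᵇ ρ w ]· (Htrunc w *ₚ g w))
      ≈⟨ +ₚ-congˡ (g bot) (*ₚ-congˡ Xₚ (Σₚ-filterᵇ (allFin n) (λ w → 2 ≤ᵇ ρ w) (λ w → Htrunc w *ₚ g w))) ⟨
    g bot +ₚ Xₚ *ₚ Σₚ rankAbove1 (λ w → Htrunc w *ₚ g w) ∎
    where open ≈-Reasoning ≈ₚ-setoid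

proposition4p13 : (P : GradedBoundedPoset) → let open Incidence P in
    (f : Inc) → IsRightKLS f →
    F f bot top ≈ₚ Z f bot top +ₚ Xₚ *ₚ Σₚ rankAbove1 (λ t → Htrunc t *ₚ Z f t top)
proposition4p13 P f kls = begin
  F f bot top
    ≈⟨ F≈Hμ·Z f kls ⟩
  (Hμ · Z f) bot top
    ≈⟨ ·-bot-top Hμ (Z f) ⟩
  ∑[ w ] Hμ bot w *ₚ Z f w top
    ≈⟨ ∑-cong (λ w → *ₚ-congʳ (Z f w top) (Hμ-values w)) ⟩
  ∑[ w ] ([ eqb w bot ]· 1ₚ +ₚ [ 2 ≤ᵇ ρ w ]· (Xₚ *ₚ Htrunc w)) *ₚ Z f w top
    ≈⟨ ∑-Hμ-values (λ w → Z f w top) ⟩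
  Z f bot top +ₚ Xₚ *ₚ Σₚ rankAbove1 (λ t → Htrunc t *ₚ Z f t top) ∎
  where
  open Incidence P
  open Whole using (_·_)
  open IncidenceAlgebra P using (·-bot-top)
  open HμRecursion P using (Hμ)
  open AugmentedChow P
  open ≈-Reasoning ≈ₚ-setoid
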